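{- For every prime $p\ge5$, the series $U_p(q):=\log\frac{t(q)^p}{t(q^p)}$ lies in $pq\mathbf{Z}_{(p)}[[q]]$. More precisely, \[ U_p(q)=12p\sum_{n\ge1}\left(\lambda(n)-\frac1p\lambda(n/p)\right)q^n, \] and if $n=p^am$ with $a\ge0$ and $p\nmid m$, then the coefficient of $q^n$ in $U_p(q)$ equals $12p\,\lambda(m)$.
   Context: $t(q)=q\prod_{n\ge1}(1-q^{3n})^{12}(1-q^n)^{ -12}$; the quotient $t(q)^p/t(q^p)$ lies in $1+q\mathbf{Z}[[q]]$ and $\log$ is the formal logarithm. $\lambda(n):=\sigma_{ -1}(n)-\sigma_{ -1}(n/3)$, where $\sigma_{ -1}(n)=\sum_{d\mid n}d^{ -1}$ and $\sigma_{ -1}(x):=0$ when $x$ is not a positive integer. -}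

module Defs where

open import Data.Nat as ℕ using (ℕ; zero; suc; _∸_)
open import Data.Nat.DivMod using (_/_)
open import Data.Nat.Divisibility using (_∣?_)
open import Data.Integer using (+_; -[1+_])
open import Data.Rational using (ℚ; 0ℚ; 1ℚ; _+_; _*_; -_; _-_)
import Data.Rational as Q
open import Data.Bool using (if_then_else_)
open import Data.Maybe using (Maybe; just; nothing)
open import Relation.Nullary using (does)

ℕ→ℚ : ℕ → ℚ
ℕ→ℚ n = + n Q./ 1

-- 1/n for n ≥ 1 (value at 0 is irrelevant and set to 0)
recipℕ : ℕ → ℚ
recipℕ zero = 0ℚ
recipℕ (suc k) = + 1 Q./ suc k

divExact : ℕ → ℕ → Maybe ℕ
divExact zero n = nothing
divExact (suc k) n = if does (suc k ∣? n) then just (n / suc k) else nothing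

sumTo : ℕ → (ℕ → ℚ) → ℚ
sumTo zero f = f 0
sumTo (suc n) f = sumTo n f + f (suc n)

PS : Set
PS = ℕ → ℚ

oneS : PS
oneS zero = 1ℚ
oneS (suc n) = 0ℚ

_⊕_ : PS → PS → PS
(f ⊕ g) n = f n + g n

_⊖_ : PS → PS → PS
(f ⊖ g) n = f n - g n

_⊛_ : PS → PS → PS
(f ⊛ g) n = sumTo n (λ i → f i * g (n ∸ i))

powS : PS → ℕ → PS
powS f zero = oneS
powS f (suc k) = powS f k ⊛ f

-- substitution q ↦ q^p
subPow : ℕ → PS → PS
subPow p f n with divExact p n
... | just m = f m
... | nothing = 0ℚ

-- multiplicative inverse of a series with constant term 1:
-- 1/f = Σ_{k≥0} (1 - f)^k ; since (1-f)^k = O(q^k), coefficient n only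
-- involves k ≤ n.
invS : PS → PS
invS f n = sumTo n (λ k → powS (oneS ⊖ f) k n)

-- formal logarithm of a series with constant term 1:
-- log f = Σ_{k≥1} (-1)^{k+1}/k (f - 1)^k ; coefficient n only involves k ≤ n.
signQ : ℕ → ℚ
signQ zero = 1ℚ
signQ (suc k) = - signQ k

logS : PS → PS
logS f n = sumTo n (λ k → signQ (suc k) * recipℕ k * powS (f ⊖ oneS) k n)

-- t(q) = q · P(q),  P(q) = ∏_{m≥1} (1-q^{3m})^{12} (1-q^m)^{-12}

oneMinusQ3 : ℕ → PS
oneMinusQ3 m zero = 1ℚ
oneMinusQ3 m (suc n) = if does (suc n ℕ.≟ 3 ℕ.* m) then - 1ℚ else 0ℚ

-- (1 - q^m)^{-1} = Σ_k q^{mk}  (for m ≥ 1)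
geomQ : ℕ → PS
geomQ m n with divExact m n
... | just _ = 1ℚ
... | nothing = 0ℚ

-- the m-th factor (1-q^{3m})^{12} (1-q^m)^{-12}, which is ≡ 1 mod q^m
factor : ℕ → PS
factor m = powS (oneMinusQ3 m) 12 ⊛ powS (geomQ m) 12

prodUpTo : ℕ → PS
prodUpTo zero = oneS
prodUpTo (suc N) = prodUpTo N ⊛ factor (suc N)

-- the infinite product: its n-th coefficient agrees with that of the
-- partial product over m ≤ n (factors with m > n are ≡ 1 mod q^{n+1})
Pser : PS
Pser n = prodUpTo n n

tSer : PS
tSer zero = 0ℚ
tSer (suc n) = Pser n

-- t(q)^p / t(q^p) = q^p P(q)^p / (q^p P(q^p)) = P(q)^p / P(q^p)
quotSer : ℕ → PS
quotSer p = powS Pser p ⊛ invS (subPow p Pser)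

U : ℕ → PS
U p = logS (quotSer p)

-- σ_{-1}(n) = Σ_{d ∣ n} 1/d  for n ≥ 1 ; σ_{-1}(0) := 0 (unused)
σ₋₁ : ℕ → ℚ
σ₋₁ n = sumTo n (λ d → if does (d ∣? n) then recipℕ d else 0ℚ)

-- σ_{-1}(n/k), which is 0 when n/k is not a positive integer
σ₋₁div : ℕ → ℕ → ℚ
σ₋₁div n k with divExact k n
... | just m = σ₋₁ m
... | nothing = 0ℚ

lam : ℕ → ℚ
lam n = σ₋₁ n - σ₋₁div n 3

lamDiv : ℕ → ℕ → ℚ
lamDiv n k with divExact k n
... | just m = lam m
... | nothing = 0ℚ

{-# OPTIONS --safe #-}
-- With θ = q d/dq, the logarithmic derivative θf/f turns products into sums, powers into
-- multiples and f(q) ↦ f(q^p) into p (θf/f)(q^p), and θ(log f) = θf/f.  For the product P,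
-- θP/P = 12 Σ (σ₁(n) − 3σ₁(n/3)) qⁿ = 12 Σ n λ(n) qⁿ, so θU_p = p (θP/P)(q) − p (θP/P)(q^p),
-- which is the coefficient formula multiplied by n.  Splitting the divisors of p^(a+1) m into
-- those of m and p times those of p^a m gives λ(p^(a+1) m) − λ(p^a m)/p = λ(m) when p ∤ 3m,
-- and such a λ(m) has denominator prime to p.

module Submission where

open import Defs
open import Data.Bool using (if_then_else_)
open import Data.Integer as ℤ using (ℤ; +_)
import Data.Integer.Properties as ℤₚ
open import Data.Maybe using (just; nothing)
open import Data.Nat using (ℕ; zero; suc; _∸_; _≤_; _<_; z≤n; s≤s; _^_; NonZero)
import Data.Nat as ℕ
import Data.Nat.Properties as ℕₚ
open import Algebra.Properties.CommutativeSemigroup ℕₚ.*-commutativeSemigroup using (xy∙z≈xz∙y)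
open import Data.Nat.Coprimality using (Coprime; coprime-divisor; 1-coprimeTo)
  renaming (sym to coprime-sym)
open import Data.Nat.Divisibility
  using (_∣_; divides; divides-refl; _∣?_; ∣-refl; ∣-trans; ∣⇒≤; >⇒∤; 0∣⇒≡0; n∣m*n; m∣m*n; n∣m*n*o;
         ∣m+n∣m⇒∣n; ∣m∸n∣n⇒∣m; ∣1⇒≡1; ∣m∣n⇒∣m+n; *-monoˡ-∣; *-monoʳ-∣; *-cancelˡ-∣; *-cancelʳ-∣;
         m*n∣⇒m∣)
open import Data.Nat.DivMod using (m*n/n≡m)
open import Data.Nat.Induction using (<-rec)
open import Data.Nat.Primality using (Prime; euclidsLemma; prime⇒irreducible; prime⇒nonTrivial)
open import Data.Product using (∃; _×_; _,_)
open import Data.Rational using (ℚ; 0ℚ; 1ℚ; _+_; _*_; -_; _-_; mkℚ; ↥_; ↧_; ↧ₙ_)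
import Data.Rational as ℚ
open import Data.Rational.Properties
open import Algebra.Properties.Group +-0-group using (inverseˡ-unique)
  renaming (∙-cancelˡ to +-cancelˡ; ⁻¹-involutive to neg-involutive)
open import Data.Rational.Solver using (module +-*-Solver)
open import Data.Sum using (inj₁; inj₂)
open import Relation.Binary.PropositionalEquality
open import Relation.Nullary using (¬_; Dec; yes; no; does)
open import Relation.Nullary.Decidable using (dec-true; dec-false)
open import Relation.Nullary.Negation using (contradiction)
open ≡-Reasoning
open +-*-Solver using (solve; _:+_; _:*_; _:-_; :-_; _:=_; con)

sumTo-cong : ∀ n {f g : ℕ → ℚ} → (∀ i → i ≤ n → f i ≡ g i) → sumTo n f ≡ sumTo n g
sumTo-cong zero     f≡g = f≡g 0 z≤n
sumTo-cong (suc n) f≡g =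
  cong₂ _+_ (sumTo-cong n (λ i i≤n → f≡g i (ℕₚ.m≤n⇒m≤1+n i≤n))) (f≡g (suc n) ℕₚ.≤-refl)

sumTo-distrib-+ : ∀ n (f g : ℕ → ℚ) → sumTo n (λ i → f i + g i) ≡ sumTo n f + sumTo n g
sumTo-distrib-+ zero    f g = refl
sumTo-distrib-+ (suc n) f g = begin
  sumTo n (λ i → f i + g i) + (f (suc n) + g (suc n))
    ≡⟨ cong (_+ (f (suc n) + g (suc n))) (sumTo-distrib-+ n f g) ⟩
  (sumTo n f + sumTo n g) + (f (suc n) + g (suc n))
    ≡⟨ solve 4 (λ a b c d → (a :+ b) :+ (c :+ d) := (a :+ c) :+ (b :+ d)) refl
               (sumTo n f) (sumTo n g) (f (suc n)) (g (suc n)) ⟩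
  (sumTo n f + f (suc n)) + (sumTo n g + g (suc n)) ∎

sumTo-*ˡ : ∀ n c (f : ℕ → ℚ) → sumTo n (λ i → c * f i) ≡ c * sumTo n f
sumTo-*ˡ zero    c f = refl
sumTo-*ˡ (suc n) c f =
  trans (cong (_+ c * f (suc n)) (sumTo-*ˡ n c f)) (sym (*-distribˡ-+ c (sumTo n f) (f (suc n))))

sumTo-*ʳ : ∀ n c (f : ℕ → ℚ) → sumTo n (λ i → f i * c) ≡ sumTo n f * c
sumTo-*ʳ n c f =
  trans (sumTo-cong n (λ i _ → *-comm (f i) c)) (trans (sumTo-*ˡ n c f) (*-comm c (sumTo n f)))

sumTo-neg : ∀ n (f : ℕ → ℚ) → sumTo n (λ i → - f i) ≡ - sumTo n f
sumTo-neg zero    f = refl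
sumTo-neg (suc n) f =
  trans (cong (_+ - f (suc n)) (sumTo-neg n f)) (sym (neg-distrib-+ (sumTo n f) (f (suc n))))

sumTo-zero : ∀ n {f : ℕ → ℚ} → (∀ i → i ≤ n → f i ≡ 0ℚ) → sumTo n f ≡ 0ℚ
sumTo-zero n f≡0 = trans (sumTo-cong n f≡0) (zeros n)
  where
  zeros : ∀ n → sumTo n (λ _ → 0ℚ) ≡ 0ℚ
  zeros zero    = refl
  zeros (suc n) = trans (cong (_+ 0ℚ) (zeros n)) (+-identityʳ 0ℚ)

sumTo-unfoldˡ : ∀ n (f : ℕ → ℚ) → sumTo (suc n) f ≡ f 0 + sumTo n (λ i → f (suc i))
sumTo-unfoldˡ zero    f = refl
sumTo-unfoldˡ (suc n) f =
  trans (cong (_+ f (suc (suc n))) (sumTo-unfoldˡ n f)) (+-assoc (f 0) _ _)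

sumTo-reverse : ∀ n (f : ℕ → ℚ) → sumTo n f ≡ sumTo n (λ i → f (n ∸ i))
sumTo-reverse zero    f = refl
sumTo-reverse (suc n) f = begin
  sumTo n f + f (suc n)                  ≡⟨ cong (_+ f (suc n)) (sumTo-reverse n f) ⟩
  sumTo n (λ i → f (n ∸ i)) + f (suc n)  ≡⟨ +-comm (sumTo n (λ i → f (n ∸ i))) (f (suc n)) ⟩
  f (suc n) + sumTo n (λ i → f (n ∸ i))  ≡⟨ sym (sumTo-unfoldˡ n (λ i → f (suc n ∸ i))) ⟩
  sumTo (suc n) (λ i → f (suc n ∸ i))    ∎

sumTo-extend : ∀ {n m} {f : ℕ → ℚ} → n ≤ m → (∀ i → n < i → i ≤ m → f i ≡ 0ℚ) →
               sumTo m f ≡ sumTo n f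
sumTo-extend {n} {zero}  z≤n  _    = refl
sumTo-extend {n} {suc m} {f} n≤1+m f≡0 with ℕₚ.m≤n⇒m<n∨m≡n n≤1+m
... | inj₂ refl         = refl
... | inj₁ (s≤s n≤m) = begin
  sumTo m f + f (suc m)
    ≡⟨ cong₂ _+_ (sumTo-extend n≤m (λ i n<i i≤m → f≡0 i n<i (ℕₚ.m≤n⇒m≤1+n i≤m)))
                 (f≡0 (suc m) (s≤s n≤m) ℕₚ.≤-refl) ⟩
  sumTo n f + 0ℚ ≡⟨ +-identityʳ _ ⟩
  sumTo n f      ∎

sumTo-single : ∀ n c {f : ℕ → ℚ} → c ≤ n → (∀ i → i ≤ n → i ≢ c → f i ≡ 0ℚ) → sumTo n f ≡ f c
sumTo-single zero .zero z≤n _ = refl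
sumTo-single (suc n) c {f} c≤1+n f≡0 with c ℕ.≟ suc n
... | yes refl = trans
  (cong (_+ f (suc n)) (sumTo-zero n (λ i i≤n → f≡0 i (ℕₚ.m≤n⇒m≤1+n i≤n) (ℕₚ.<⇒≢ (s≤s i≤n)))))
  (+-identityˡ _)
... | no c≢1+n = trans
  (cong₂ _+_ (sumTo-single n c (ℕₚ.≤-pred (ℕₚ.≤∧≢⇒< c≤1+n c≢1+n))
                            (λ i i≤n → f≡0 i (ℕₚ.m≤n⇒m≤1+n i≤n)))
             (f≡0 (suc n) ℕₚ.≤-refl (λ e → c≢1+n (sym e))))
  (+-identityʳ _)

sumTo-comm : ∀ n m (F : ℕ → ℕ → ℚ) →
             sumTo n (λ i → sumTo m (F i)) ≡ sumTo m (λ j → sumTo n (λ i → F i j))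
sumTo-comm zero    m F = refl
sumTo-comm (suc n) m F = begin
  sumTo n (λ i → sumTo m (F i)) + sumTo m (F (suc n))
    ≡⟨ cong (_+ sumTo m (F (suc n))) (sumTo-comm n m F) ⟩
  sumTo m (λ j → sumTo n (λ i → F i j)) + sumTo m (F (suc n))
    ≡⟨ sym (sumTo-distrib-+ m _ _) ⟩
  sumTo m (λ j → sumTo n (λ i → F i j) + F (suc n) j) ∎

sumTo-comm-triangle : ∀ n (F : ℕ → ℕ → ℚ) →
  sumTo n (λ i → sumTo i (F i)) ≡ sumTo n (λ j → sumTo (n ∸ j) (λ k → F (j ℕ.+ k) j))
sumTo-comm-triangle zero    F = refl
sumTo-comm-triangle (suc n) F = begin
  sumTo n (λ i → sumTo i (F i)) + sumTo (suc n) (F (suc n))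
    ≡⟨ cong (_+ sumTo (suc n) (F (suc n))) (sumTo-comm-triangle n F) ⟩
  Tri n + (sumTo n (F (suc n)) + F (suc n) (suc n))
    ≡⟨ sym (+-assoc (Tri n) (sumTo n (F (suc n))) (F (suc n) (suc n))) ⟩
  (Tri n + sumTo n (F (suc n))) + F (suc n) (suc n)
    ≡⟨ cong₂ _+_ (trans (sym (sumTo-distrib-+ n _ _)) (sumTo-cong n (λ j j≤n → sym (column j j≤n))))
                 (cong (λ x → F x (suc n)) (sym (ℕₚ.+-identityʳ (suc n)))) ⟩
  sumTo n (λ j → sumTo (suc n ∸ j) (λ k → F (j ℕ.+ k) j)) + F (suc n ℕ.+ 0) (suc n)
    ≡⟨ cong (λ z → sumTo n (λ j → sumTo (suc n ∸ j) (λ k → F (j ℕ.+ k) j))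
                   + sumTo z (λ k → F (suc n ℕ.+ k) (suc n)))
            (sym (ℕₚ.n∸n≡0 n)) ⟩
  sumTo (suc n) (λ j → sumTo (suc n ∸ j) (λ k → F (j ℕ.+ k) j)) ∎
  where
  Tri : ℕ → ℚ
  Tri n = sumTo n (λ j → sumTo (n ∸ j) (λ k → F (j ℕ.+ k) j))
  column : ∀ j → j ≤ n → sumTo (suc n ∸ j) (λ k → F (j ℕ.+ k) j)
                         ≡ sumTo (n ∸ j) (λ k → F (j ℕ.+ k) j) + F (suc n) j
  column j j≤n rewrite ℕₚ.+-∸-assoc 1 j≤n =
    cong (λ x → sumTo (n ∸ j) (λ k → F (j ℕ.+ k) j) + F x j)
         (trans (ℕₚ.+-suc j (n ∸ j)) (cong suc (ℕₚ.m+[n∸m]≡n j≤n)))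

if-dec-yes : ∀ {A B : Set} (a? : Dec A) {x y : B} → A → (if does a? then x else y) ≡ x
if-dec-yes a? a rewrite dec-true a? a = refl

if-dec-no : ∀ {A B : Set} (a? : Dec A) {x y : B} → ¬ A → (if does a? then x else y) ≡ y
if-dec-no a? ¬a rewrite dec-false a? ¬a = refl

sumTo-unique-solution : ∀ n (P : ℕ → ℕ) (W : ℕ → ℚ) c → c ≤ n → (∀ b → P b ≡ n → b ≡ c) → P c ≡ n →
                        sumTo n (λ b → if does (P b ℕ.≟ n) then W b else 0ℚ) ≡ W c
sumTo-unique-solution n P W c c≤n unique Pc≡n =
  trans (sumTo-single n c c≤n (λ b _ b≢c → if-dec-no (P b ℕ.≟ n) (λ Pb≡n → b≢c (unique b Pb≡n))))
        (if-dec-yes (P c ℕ.≟ n) Pc≡n)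

sumTo-no-solution : ∀ n (P : ℕ → ℕ) (W : ℕ → ℚ) → (∀ b → P b ≢ n) →
                    sumTo n (λ b → if does (P b ℕ.≟ n) then W b else 0ℚ) ≡ 0ℚ
sumTo-no-solution n P W none = sumTo-zero n (λ b _ → if-dec-no (P b ℕ.≟ n) (none b))

ℕ→ℚ≡mkℚ : ∀ n → ℕ→ℚ n ≡ mkℚ (+ n) 0 (coprime-sym (1-coprimeTo n))
ℕ→ℚ≡mkℚ n = normalize-coprime (coprime-sym (1-coprimeTo n))

ℕ→ℚ-+ : ∀ a b → ℕ→ℚ (a ℕ.+ b) ≡ ℕ→ℚ a + ℕ→ℚ b
ℕ→ℚ-+ a b rewrite ℕ→ℚ≡mkℚ a | ℕ→ℚ≡mkℚ b =
  cong (ℚ._/ 1) (trans (ℤₚ.pos-+ a b) (sym (cong₂ ℤ._+_ (ℤₚ.*-identityʳ (+ a)) (ℤₚ.*-identityʳ (+ b)))))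

ℕ→ℚ-* : ∀ a b → ℕ→ℚ (a ℕ.* b) ≡ ℕ→ℚ a * ℕ→ℚ b
ℕ→ℚ-* a b rewrite ℕ→ℚ≡mkℚ a | ℕ→ℚ≡mkℚ b = cong (ℚ._/ 1) (ℤₚ.pos-* a b)

recipℕ-inverseˡ : ∀ k → recipℕ (suc k) * ℕ→ℚ (suc k) ≡ 1ℚ
recipℕ-inverseˡ k = begin
  recipℕ (suc k) * ℕ→ℚ (suc k) ≡⟨ cong₂ _*_ (normalize-coprime (1-coprimeTo (suc k))) (ℕ→ℚ≡mkℚ (suc k)) ⟩
  (ℚ.1/ [1+k]) * [1+k]         ≡⟨ *-inverseˡ [1+k] ⟩
  1ℚ                           ∎
  where
  [1+k] : ℚ
  [1+k] = mkℚ (+ suc k) 0 (coprime-sym (1-coprimeTo (suc k)))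

recipℕ-unique : ∀ k y → y * ℕ→ℚ (suc k) ≡ 1ℚ → y ≡ recipℕ (suc k)
recipℕ-unique k y y·[1+k]≡1 = begin
  y                                    ≡⟨ sym (*-identityʳ y) ⟩
  y * 1ℚ                               ≡⟨ cong (y *_) (sym (recipℕ-inverseˡ k)) ⟩
  y * (recipℕ (suc k) * ℕ→ℚ (suc k))   ≡⟨ solve 3 (λ a b c → a :* (b :* c) := b :* (a :* c)) refl
                                                   y (recipℕ (suc k)) (ℕ→ℚ (suc k)) ⟩
  recipℕ (suc k) * (y * ℕ→ℚ (suc k))   ≡⟨ cong (recipℕ (suc k) *_) y·[1+k]≡1 ⟩
  recipℕ (suc k) * 1ℚ                  ≡⟨ *-identityʳ _ ⟩
  recipℕ (suc k)                       ∎

recipℕ-* : ∀ a b → recipℕ (suc a ℕ.* suc b) ≡ recipℕ (suc a) * recipℕ (suc b)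
recipℕ-* a b = sym (recipℕ-unique (b ℕ.+ a ℕ.* suc b) _ (begin
  recipℕ (suc a) * recipℕ (suc b) * ℕ→ℚ (suc a ℕ.* suc b)
    ≡⟨ cong (recipℕ (suc a) * recipℕ (suc b) *_) (ℕ→ℚ-* (suc a) (suc b)) ⟩
  recipℕ (suc a) * recipℕ (suc b) * (ℕ→ℚ (suc a) * ℕ→ℚ (suc b))
    ≡⟨ solve 4 (λ x y u v → x :* y :* (u :* v) := (x :* u) :* (y :* v)) refl
               (recipℕ (suc a)) (recipℕ (suc b)) (ℕ→ℚ (suc a)) (ℕ→ℚ (suc b)) ⟩
  (recipℕ (suc a) * ℕ→ℚ (suc a)) * (recipℕ (suc b) * ℕ→ℚ (suc b))
    ≡⟨ cong₂ _*_ (recipℕ-inverseˡ a) (recipℕ-inverseˡ b) ⟩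
  1ℚ ∎))

ℕ→ℚ-*-cancelˡ : ∀ k {x y} → ℕ→ℚ (suc k) * x ≡ ℕ→ℚ (suc k) * y → x ≡ y
ℕ→ℚ-*-cancelˡ k {x} {y} eq = begin
  x                                    ≡⟨ sym (*-identityˡ x) ⟩
  1ℚ * x                               ≡⟨ cong (_* x) (sym (recipℕ-inverseˡ k)) ⟩
  recipℕ (suc k) * ℕ→ℚ (suc k) * x     ≡⟨ *-assoc (recipℕ (suc k)) _ x ⟩
  recipℕ (suc k) * (ℕ→ℚ (suc k) * x)   ≡⟨ cong (recipℕ (suc k) *_) eq ⟩
  recipℕ (suc k) * (ℕ→ℚ (suc k) * y)   ≡⟨ sym (*-assoc (recipℕ (suc k)) _ y) ⟩
  recipℕ (suc k) * ℕ→ℚ (suc k) * y     ≡⟨ cong (_* y) (recipℕ-inverseˡ k) ⟩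
  1ℚ * y                               ≡⟨ *-identityˡ y ⟩
  y                                    ∎

infix 4 _≈_
_≈_ : PS → PS → Set
f ≈ g = ∀ n → f n ≡ g n

≈-sym : ∀ {f g} → f ≈ g → g ≈ f
≈-sym f≈g n = sym (f≈g n)

≈-trans : ∀ {f g h} → f ≈ g → g ≈ h → f ≈ h
≈-trans f≈g g≈h n = trans (f≈g n) (g≈h n)

zeroS : PS
zeroS _ = 0ℚ

negS : PS → PS
negS f n = - f n

scaleS : ℚ → PS → PS
scaleS c f n = c * f n

⊛-cong-upTo : ∀ n {f f′ g g′ : PS} → (∀ i → i ≤ n → f i ≡ f′ i) → (∀ i → i ≤ n → g i ≡ g′ i) →
              (f ⊛ g) n ≡ (f′ ⊛ g′) n
⊛-cong-upTo n f≡ g≡ = sumTo-cong n (λ i i≤n → cong₂ _*_ (f≡ i i≤n) (g≡ (n ∸ i) (ℕₚ.m∸n≤m n i)))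

⊛-cong : ∀ {f f′ g g′} → f ≈ f′ → g ≈ g′ → (f ⊛ g) ≈ (f′ ⊛ g′)
⊛-cong f≈ g≈ n = ⊛-cong-upTo n (λ i _ → f≈ i) (λ i _ → g≈ i)

⊛-congˡ : ∀ {f f′} g → f ≈ f′ → (f ⊛ g) ≈ (f′ ⊛ g)
⊛-congˡ g f≈ = ⊛-cong {g = g} f≈ (λ _ → refl)

⊛-congʳ : ∀ f {g g′} → g ≈ g′ → (f ⊛ g) ≈ (f ⊛ g′)
⊛-congʳ f g≈ = ⊛-cong {f} (λ _ → refl) g≈

⊛-comm : ∀ f g → (f ⊛ g) ≈ (g ⊛ f)
⊛-comm f g n = begin
  sumTo n (λ i → f i * g (n ∸ i))             ≡⟨ sumTo-reverse n _ ⟩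
  sumTo n (λ i → f (n ∸ i) * g (n ∸ (n ∸ i))) ≡⟨ sumTo-cong n swap ⟩
  sumTo n (λ i → g i * f (n ∸ i))             ∎
  where
  swap : ∀ i → i ≤ n → f (n ∸ i) * g (n ∸ (n ∸ i)) ≡ g i * f (n ∸ i)
  swap i i≤n = trans (cong (λ j → f (n ∸ i) * g j) (ℕₚ.m∸[m∸n]≡n i≤n)) (*-comm (f (n ∸ i)) (g i))

⊛-assoc : ∀ f g h → ((f ⊛ g) ⊛ h) ≈ (f ⊛ (g ⊛ h))
⊛-assoc f g h n = begin
  sumTo n (λ i → sumTo i (λ j → f j * g (i ∸ j)) * h (n ∸ i))
    ≡⟨ sumTo-cong n (λ i _ → sym (sumTo-*ʳ i (h (n ∸ i)) (λ j → f j * g (i ∸ j)))) ⟩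
  sumTo n (λ i → sumTo i (λ j → f j * g (i ∸ j) * h (n ∸ i)))
    ≡⟨ sumTo-comm-triangle n (λ i j → f j * g (i ∸ j) * h (n ∸ i)) ⟩
  sumTo n (λ j → sumTo (n ∸ j) (λ k → f j * g ((j ℕ.+ k) ∸ j) * h (n ∸ (j ℕ.+ k))))
    ≡⟨ sumTo-cong n (λ j _ → trans (sumTo-cong (n ∸ j) (λ k _ → reindex j k))
                                   (sumTo-*ˡ (n ∸ j) (f j) (λ k → g k * h (n ∸ j ∸ k)))) ⟩
  sumTo n (λ j → f j * sumTo (n ∸ j) (λ k → g k * h (n ∸ j ∸ k))) ∎
  where
  reindex : ∀ j k → f j * g ((j ℕ.+ k) ∸ j) * h (n ∸ (j ℕ.+ k)) ≡ f j * (g k * h (n ∸ j ∸ k))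
  reindex j k = trans (cong₂ (λ a b → f j * g a * h b) (ℕₚ.m+n∸m≡n j k) (sym (ℕₚ.∸-+-assoc n j k)))
                      (*-assoc (f j) (g k) (h (n ∸ j ∸ k)))

⊛-identityˡ : ∀ f → (oneS ⊛ f) ≈ f
⊛-identityˡ f zero    = *-identityˡ (f 0)
⊛-identityˡ f (suc n) = begin
  (oneS ⊛ f) (suc n)                                    ≡⟨ sumTo-unfoldˡ n (λ i → oneS i * f (suc n ∸ i)) ⟩
  1ℚ * f (suc n) + sumTo n (λ i → 0ℚ * f (n ∸ i))       ≡⟨ cong₂ _+_ (*-identityˡ (f (suc n)))
                                                                     (sumTo-zero n (λ i _ → *-zeroˡ (f (n ∸ i)))) ⟩
  f (suc n) + 0ℚ                                        ≡⟨ +-identityʳ _ ⟩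
  f (suc n)                                             ∎

⊛-identityʳ : ∀ f → (f ⊛ oneS) ≈ f
⊛-identityʳ f = ≈-trans (⊛-comm f oneS) (⊛-identityˡ f)

⊛-distribʳ-⊕ : ∀ f g h → ((f ⊕ g) ⊛ h) ≈ ((f ⊛ h) ⊕ (g ⊛ h))
⊛-distribʳ-⊕ f g h n = trans (sumTo-cong n (λ i _ → *-distribʳ-+ (h (n ∸ i)) (f i) (g i))) (sumTo-distrib-+ n _ _)

⊛-distribˡ-⊕ : ∀ h f g → (h ⊛ (f ⊕ g)) ≈ ((h ⊛ f) ⊕ (h ⊛ g))
⊛-distribˡ-⊕ h f g n = trans (sumTo-cong n (λ i _ → *-distribˡ-+ (h i) (f (n ∸ i)) (g (n ∸ i)))) (sumTo-distrib-+ n _ _)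

⊛-scaleˡ : ∀ c f g → (scaleS c f ⊛ g) ≈ scaleS c (f ⊛ g)
⊛-scaleˡ c f g n = trans (sumTo-cong n (λ i _ → *-assoc c (f i) (g (n ∸ i)))) (sumTo-*ˡ n c _)

⊛-scaleʳ : ∀ c f g → (f ⊛ scaleS c g) ≈ scaleS c (f ⊛ g)
⊛-scaleʳ c f g = ≈-trans (⊛-comm f (scaleS c g)) (≈-trans (⊛-scaleˡ c g f) (λ n → cong (c *_) (⊛-comm g f n)))

⊛-negˡ : ∀ f g → (negS f ⊛ g) ≈ negS (f ⊛ g)
⊛-negˡ f g n = trans (sumTo-cong n (λ i _ → sym (neg-distribˡ-* (f i) (g (n ∸ i))))) (sumTo-neg n _)

⊛-negʳ : ∀ f g → (f ⊛ negS g) ≈ negS (f ⊛ g)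
⊛-negʳ f g = ≈-trans (⊛-comm f (negS g)) (≈-trans (⊛-negˡ g f) (λ n → cong -_ (⊛-comm g f n)))

⊛-zeroˡ : ∀ f → (zeroS ⊛ f) ≈ zeroS
⊛-zeroˡ f n = sumTo-zero n (λ i _ → *-zeroˡ (f (n ∸ i)))

⊛-oneS-⊖ʳ : ∀ f g → (f ⊛ (oneS ⊖ g)) ≈ (f ⊖ (f ⊛ g))
⊛-oneS-⊖ʳ f g n = trans (⊛-distribˡ-⊕ f oneS (negS g) n)
                       (cong₂ _+_ (⊛-identityʳ f n) (⊛-negʳ f g n))

powS-zero-coeff : ∀ f k → f 0 ≡ 1ℚ → powS f k 0 ≡ 1ℚ
powS-zero-coeff f zero    f₀ = refl
powS-zero-coeff f (suc k) f₀ = trans (cong₂ _*_ (powS-zero-coeff f k f₀) f₀) (*-identityˡ 1ℚ)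

VanishesBelow : ℕ → PS → Set
VanishesBelow k f = ∀ n → n < k → f n ≡ 0ℚ

⊛-vanishesBelow : ∀ a b {f g} → VanishesBelow a f → VanishesBelow b g → VanishesBelow (a ℕ.+ b) (f ⊛ g)
⊛-vanishesBelow a b {f} {g} f≡0 g≡0 n n<a+b = sumTo-zero n term≡0
  where
  term≡0 : ∀ i → i ≤ n → f i * g (n ∸ i) ≡ 0ℚ
  term≡0 i i≤n with i ℕ.<? a
  ... | yes i<a = trans (cong (_* g (n ∸ i)) (f≡0 i i<a)) (*-zeroˡ (g (n ∸ i)))
  ... | no  i≮a = trans (cong (f i *_) (g≡0 (n ∸ i) n∸i<b)) (*-zeroʳ (f i))
    where
    n∸i<b : n ∸ i < b
    n∸i<b = ℕₚ.+-cancelˡ-< i (n ∸ i) b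
      (ℕₚ.≤-<-trans (ℕₚ.≤-reflexive (ℕₚ.m+[n∸m]≡n i≤n))
                    (ℕₚ.<-≤-trans n<a+b (ℕₚ.+-monoˡ-≤ b (ℕₚ.≮⇒≥ i≮a))))

powS-vanishesBelow : ∀ h → h 0 ≡ 0ℚ → ∀ k → VanishesBelow k (powS h k)
powS-vanishesBelow h h₀ zero    n ()
powS-vanishesBelow h h₀ (suc k) =
  subst (λ j → VanishesBelow j (powS h (suc k))) (ℕₚ.+-comm k 1)
        (⊛-vanishesBelow k 1 (powS-vanishesBelow h h₀ k) h≡0)
  where
  h≡0 : VanishesBelow 1 h
  h≡0 zero    _ = h₀
  h≡0 (suc n) (s≤s ())

sumTo-coeff-truncate : (P : ℕ → PS) → (∀ k → VanishesBelow k (P k)) →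
                       ∀ {n N} → n ≤ N → sumTo N (λ k → P k n) ≡ sumTo n (λ k → P k n)
sumTo-coeff-truncate P P≡0 {n} n≤N = sumTo-extend n≤N (λ k n<k _ → P≡0 k n n<k)

IsOneBelow : ℕ → PS → Set
IsOneBelow k f = ∀ n → n < k → f n ≡ oneS n

⊛-isOneBelowʳ : ∀ k g {f} → IsOneBelow k f → ∀ n → n < k → (g ⊛ f) n ≡ g n
⊛-isOneBelowʳ k g f≡1 n n<k =
  trans (⊛-cong-upTo n {f = g} (λ _ _ → refl) (λ i i≤n → f≡1 i (ℕₚ.≤-<-trans i≤n n<k))) (⊛-identityʳ g n)

⊛-isOneBelow : ∀ k {f g} → IsOneBelow k f → IsOneBelow k g → IsOneBelow k (f ⊛ g)
⊛-isOneBelow k {f} f≡1 g≡1 n n<k = trans (⊛-isOneBelowʳ k f g≡1 n n<k) (f≡1 n n<k)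

powS-isOneBelow : ∀ k {f} → IsOneBelow k f → ∀ j → IsOneBelow k (powS f j)
powS-isOneBelow k f≡1 zero    n _ = refl
powS-isOneBelow k f≡1 (suc j) = ⊛-isOneBelow k (powS-isOneBelow k f≡1 j) f≡1

-- The Euler operator θ = q d/dq and logarithmic derivatives

θ : PS → PS
θ f n = ℕ→ℚ n * f n

θ-cong : ∀ {f g} → f ≈ g → θ f ≈ θ g
θ-cong f≈g n = cong (ℕ→ℚ n *_) (f≈g n)

θ-⊛ : ∀ f g → θ (f ⊛ g) ≈ ((θ f ⊛ g) ⊕ (f ⊛ θ g))
θ-⊛ f g n = begin
  ℕ→ℚ n * sumTo n (λ i → f i * g (n ∸ i))
    ≡⟨ sym (sumTo-*ˡ n (ℕ→ℚ n) _) ⟩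
  sumTo n (λ i → ℕ→ℚ n * (f i * g (n ∸ i)))
    ≡⟨ sumTo-cong n leibniz ⟩
  sumTo n (λ i → ℕ→ℚ i * f i * g (n ∸ i) + f i * (ℕ→ℚ (n ∸ i) * g (n ∸ i)))
    ≡⟨ sumTo-distrib-+ n _ _ ⟩
  ((θ f ⊛ g) ⊕ (f ⊛ θ g)) n ∎
  where
  leibniz : ∀ i → i ≤ n →
            ℕ→ℚ n * (f i * g (n ∸ i)) ≡ ℕ→ℚ i * f i * g (n ∸ i) + f i * (ℕ→ℚ (n ∸ i) * g (n ∸ i))
  leibniz i i≤n = begin
    ℕ→ℚ n * (f i * g (n ∸ i))
      ≡⟨ cong (λ m → ℕ→ℚ m * (f i * g (n ∸ i))) (sym (ℕₚ.m+[n∸m]≡n i≤n)) ⟩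
    ℕ→ℚ (i ℕ.+ (n ∸ i)) * (f i * g (n ∸ i))
      ≡⟨ cong (_* (f i * g (n ∸ i))) (ℕ→ℚ-+ i (n ∸ i)) ⟩
    (ℕ→ℚ i + ℕ→ℚ (n ∸ i)) * (f i * g (n ∸ i))
      ≡⟨ solve 4 (λ a b x y → (a :+ b) :* (x :* y) := a :* x :* y :+ x :* (b :* y))
                 refl (ℕ→ℚ i) (ℕ→ℚ (n ∸ i)) (f i) (g (n ∸ i)) ⟩
    ℕ→ℚ i * f i * g (n ∸ i) + f i * (ℕ→ℚ (n ∸ i) * g (n ∸ i)) ∎

θ-oneS : θ oneS ≈ zeroS
θ-oneS zero    = refl
θ-oneS (suc n) = *-zeroʳ (ℕ→ℚ (suc n))

θ-powS : ∀ h k → θ (powS h (suc k)) ≈ scaleS (ℕ→ℚ (suc k)) (powS h k ⊛ θ h)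
θ-powS h zero n = begin
  ℕ→ℚ n * (oneS ⊛ h) n ≡⟨ cong (ℕ→ℚ n *_) (⊛-identityˡ h n) ⟩
  θ h n                ≡⟨ sym (⊛-identityˡ (θ h) n) ⟩
  (oneS ⊛ θ h) n       ≡⟨ sym (*-identityˡ _) ⟩
  1ℚ * (oneS ⊛ θ h) n  ∎
θ-powS h (suc k) n = begin
  θ (hᵏ⁺¹ ⊛ h) n
    ≡⟨ θ-⊛ hᵏ⁺¹ h n ⟩
  (θ hᵏ⁺¹ ⊛ h) n + X
    ≡⟨ cong (_+ X) (⊛-congˡ h (θ-powS h k) n) ⟩
  (scaleS K (powS h k ⊛ θ h) ⊛ h) n + X
    ≡⟨ cong (_+ X) (⊛-scaleˡ K (powS h k ⊛ θ h) h n) ⟩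
  K * ((powS h k ⊛ θ h) ⊛ h) n + X
    ≡⟨ cong (λ z → K * z + X) (trans (⊛-assoc (powS h k) (θ h) h n)
                              (trans (⊛-congʳ (powS h k) (⊛-comm (θ h) h) n)
                                     (sym (⊛-assoc (powS h k) h (θ h) n)))) ⟩
  K * X + X
    ≡⟨ solve 2 (λ a x → a :* x :+ x := (con 1ℚ :+ a) :* x) refl K X ⟩
  (1ℚ + K) * X
    ≡⟨ cong (_* X) (sym (ℕ→ℚ-+ 1 (suc k))) ⟩
  ℕ→ℚ (suc (suc k)) * X ∎
  where
  hᵏ⁺¹ = powS h (suc k)
  K = ℕ→ℚ (suc k)
  X = (hᵏ⁺¹ ⊛ θ h) n

record LogDeriv (f a : PS) : Set where
  constructor logDeriv
  field θ≈a⊛f : θ f ≈ (a ⊛ f)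

open LogDeriv

⊛-cancelʳ : ∀ f {d e} → f 0 ≡ 1ℚ → (d ⊛ f) ≈ (e ⊛ f) → d ≈ e
⊛-cancelʳ f {d} {e} f₀ df≈ef n = agree n n ℕₚ.≤-refl
  where
  agree : ∀ m i → i ≤ m → d i ≡ e i
  agree zero    .zero z≤n = begin
    d 0        ≡⟨ sym (trans (cong (d 0 *_) f₀) (*-identityʳ (d 0))) ⟩
    d 0 * f 0  ≡⟨ df≈ef 0 ⟩
    e 0 * f 0  ≡⟨ trans (cong (e 0 *_) f₀) (*-identityʳ (e 0)) ⟩
    e 0        ∎
  agree (suc m) i i≤1+m with ℕₚ.m≤n⇒m<n∨m≡n i≤1+m
  ... | inj₁ (s≤s i≤m) = agree m i i≤m
  ... | inj₂ refl      = begin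
    d (suc m)                        ≡⟨ sym (times-f₀ d) ⟩
    d (suc m) * f (m ∸ m)            ≡⟨ +-cancelˡ (lower d) _ _ (trans (df≈ef (suc m))
                                         (cong (_+ e (suc m) * f (m ∸ m)) (sym lower-agree))) ⟩
    e (suc m) * f (m ∸ m)            ≡⟨ times-f₀ e ⟩
    e (suc m)                        ∎
    where
    lower : PS → ℚ
    lower g = sumTo m (λ j → g j * f (suc m ∸ j))
    lower-agree : lower d ≡ lower e
    lower-agree = sumTo-cong m (λ j j≤m → cong (_* f (suc m ∸ j)) (agree m j j≤m))
    times-f₀ : ∀ g → g (suc m) * f (m ∸ m) ≡ g (suc m)
    times-f₀ g = trans (cong (g (suc m) *_) (trans (cong f (ℕₚ.n∸n≡0 m)) f₀)) (*-identityʳ _)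

logDeriv-unique : ∀ f {a b} → f 0 ≡ 1ℚ → LogDeriv f a → LogDeriv f b → a ≈ b
logDeriv-unique f f₀ la lb = ⊛-cancelʳ f f₀ (≈-trans (≈-sym (θ≈a⊛f la)) (θ≈a⊛f lb))

logDeriv-cong : ∀ {f f′ a a′} → f ≈ f′ → a ≈ a′ → LogDeriv f a → LogDeriv f′ a′
logDeriv-cong f≈ a≈ (logDeriv l) = logDeriv λ n → trans (sym (θ-cong f≈ n)) (trans (l n) (⊛-cong a≈ f≈ n))

logDeriv-oneS : LogDeriv oneS zeroS
logDeriv-oneS = logDeriv λ n → trans (θ-oneS n) (sym (⊛-zeroˡ oneS n))

logDeriv-⊛ : ∀ {f g a b} → LogDeriv f a → LogDeriv g b → LogDeriv (f ⊛ g) (a ⊕ b)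
logDeriv-⊛ {f} {g} {a} {b} (logDeriv la) (logDeriv lb) = logDeriv λ n → begin
  θ (f ⊛ g) n                         ≡⟨ θ-⊛ f g n ⟩
  (θ f ⊛ g) n + (f ⊛ θ g) n           ≡⟨ cong₂ _+_ (⊛-congˡ g la n) (⊛-congʳ f lb n) ⟩
  ((a ⊛ f) ⊛ g) n + (f ⊛ (b ⊛ g)) n   ≡⟨ cong₂ _+_ (⊛-assoc a f g n) (exchange n) ⟩
  (a ⊛ (f ⊛ g)) n + (b ⊛ (f ⊛ g)) n   ≡⟨ sym (⊛-distribʳ-⊕ a b (f ⊛ g) n) ⟩
  ((a ⊕ b) ⊛ (f ⊛ g)) n               ∎
  where
  exchange : ∀ n → (f ⊛ (b ⊛ g)) n ≡ (b ⊛ (f ⊛ g)) n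
  exchange n = trans (sym (⊛-assoc f b g n)) (trans (⊛-congˡ g (⊛-comm f b) n) (⊛-assoc b f g n))

logDeriv-powS : ∀ {f a} → LogDeriv f a → ∀ k → LogDeriv (powS f k) (scaleS (ℕ→ℚ k) a)
logDeriv-powS {a = a} l zero    = logDeriv-cong (λ _ → refl) (λ n → sym (*-zeroˡ (a n))) logDeriv-oneS
logDeriv-powS {a = a} l (suc k) =
  logDeriv-cong (λ _ → refl) k·a+a≈ (logDeriv-⊛ (logDeriv-powS l k) l)
  where
  k·a+a≈ : (scaleS (ℕ→ℚ k) a ⊕ a) ≈ scaleS (ℕ→ℚ (suc k)) a
  k·a+a≈ n = trans (solve 2 (λ K x → K :* x :+ x := (con 1ℚ :+ K) :* x) refl (ℕ→ℚ k) (a n))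
                   (cong (_* a n) (sym (ℕ→ℚ-+ 1 k)))

logDeriv-inverse : ∀ {f g a} → (g ⊛ f) ≈ oneS → f 0 ≡ 1ℚ → LogDeriv f a → LogDeriv g (negS a)
logDeriv-inverse {f} {g} {a} gf≈1 f₀ (logDeriv l) = logDeriv (⊛-cancelʳ f f₀ θg·f≈)
  where
  θg·f≈ : (θ g ⊛ f) ≈ ((negS a ⊛ g) ⊛ f)
  θg·f≈ n = begin
    (θ g ⊛ f) n                ≡⟨ inverseˡ-unique _ _ (begin
                                    (θ g ⊛ f) n + (g ⊛ θ f) n ≡⟨ sym (θ-⊛ g f n) ⟩
                                    θ (g ⊛ f) n               ≡⟨ θ-cong gf≈1 n ⟩
                                    θ oneS n                  ≡⟨ θ-oneS n ⟩
                                    0ℚ                        ∎) ⟩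
    - (g ⊛ θ f) n              ≡⟨ cong -_ (⊛-congʳ g l n) ⟩
    - (g ⊛ (a ⊛ f)) n          ≡⟨ cong -_ (sym (⊛-assoc g a f n)) ⟩
    - ((g ⊛ a) ⊛ f) n          ≡⟨ cong -_ (⊛-congˡ f (⊛-comm g a) n) ⟩
    - ((a ⊛ g) ⊛ f) n          ≡⟨ sym (⊛-negˡ (a ⊛ g) f n) ⟩
    (negS (a ⊛ g) ⊛ f) n       ≡⟨ ⊛-congˡ f (≈-sym (⊛-negˡ a g)) n ⟩
    ((negS a ⊛ g) ⊛ f) n       ∎

geomSum : PS → ℕ → PS
geomSum x N n = sumTo N (λ k → powS x k n)

geomSum-telescope : ∀ x N → (geomSum x N ⊛ (oneS ⊖ x)) ≈ (oneS ⊖ powS x (suc N))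
geomSum-telescope x zero n = begin
  (oneS ⊛ (oneS ⊖ x)) n ≡⟨ ⊛-identityˡ (oneS ⊖ x) n ⟩
  oneS n - x n          ≡⟨ cong (λ z → oneS n - z) (sym (⊛-identityˡ x n)) ⟩
  oneS n - powS x 1 n   ∎
geomSum-telescope x (suc N) n = begin
  ((geomSum x N ⊕ xᴺ⁺¹) ⊛ (oneS ⊖ x)) n
    ≡⟨ ⊛-distribʳ-⊕ (geomSum x N) xᴺ⁺¹ (oneS ⊖ x) n ⟩
  (geomSum x N ⊛ (oneS ⊖ x)) n + (xᴺ⁺¹ ⊛ (oneS ⊖ x)) n
    ≡⟨ cong₂ _+_ (geomSum-telescope x N n) (⊛-oneS-⊖ʳ xᴺ⁺¹ x n) ⟩
  (oneS n - xᴺ⁺¹ n) + (xᴺ⁺¹ n - powS x (suc (suc N)) n)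
    ≡⟨ solve 3 (λ o a b → (o :- a) :+ (a :- b) := o :- b) refl (oneS n) (xᴺ⁺¹ n) (powS x (suc (suc N)) n) ⟩
  oneS n - powS x (suc (suc N)) n ∎
  where
  xᴺ⁺¹ = powS x (suc N)

invS-inverseˡ : ∀ f → f 0 ≡ 1ℚ → (invS f ⊛ f) ≈ oneS
invS-inverseˡ f f₀ n = begin
  (invS f ⊛ f) n
    ≡⟨ ⊛-cong-upTo n (λ i i≤n → sym (sumTo-coeff-truncate (powS u) (powS-vanishesBelow u u₀) i≤n))
                     (λ j _ → refl {x = f j}) ⟩
  (geomSum u n ⊛ f) n
    ≡⟨ ⊛-congʳ (geomSum u n) f≈1-u n ⟩
  (geomSum u n ⊛ (oneS ⊖ u)) n
    ≡⟨ geomSum-telescope u n n ⟩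
  oneS n - powS u (suc n) n
    ≡⟨ cong (λ z → oneS n - z) (powS-vanishesBelow u u₀ (suc n) n ℕₚ.≤-refl) ⟩
  oneS n - 0ℚ
    ≡⟨ +-identityʳ (oneS n) ⟩
  oneS n ∎
  where
  u = oneS ⊖ f
  u₀ : u 0 ≡ 0ℚ
  u₀ = trans (cong (λ z → 1ℚ - z) f₀) (+-inverseʳ 1ℚ)
  f≈1-u : f ≈ (oneS ⊖ u)
  f≈1-u n = solve 2 (λ x o → x := o :- (o :- x)) refl (f n) (oneS n)

module _ (f : PS) (f₀ : f 0 ≡ 1ℚ) where

  private
    h : PS
    h = f ⊖ oneS

    -h₀ : negS h 0 ≡ 0ℚ
    -h₀ = cong (λ c → - (c - 1ℚ)) f₀

    logTerm : ℕ → PS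
    logTerm k n = signQ (suc k) * recipℕ k * powS h k n

    logTrunc : ℕ → PS
    logTrunc N n = sumTo N (λ k → logTerm k n)

    logTerm-vanishesBelow : ∀ k → VanishesBelow k (logTerm k)
    logTerm-vanishesBelow k n n<k = trans (cong (signQ (suc k) * recipℕ k *_) (powS-vanishesBelow h (cong (_- 1ℚ) f₀) k n n<k))
                                          (*-zeroʳ (signQ (suc k) * recipℕ k))

    powS-negS : ∀ k → powS (negS h) k ≈ scaleS (signQ k) (powS h k)
    powS-negS zero    n = sym (*-identityˡ (oneS n))
    powS-negS (suc k) n = begin
      (powS (negS h) k ⊛ negS h) n            ≡⟨ ⊛-negʳ (powS (negS h) k) h n ⟩
      - (powS (negS h) k ⊛ h) n               ≡⟨ cong -_ (⊛-congˡ h (powS-negS k) n) ⟩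
      - (scaleS (signQ k) (powS h k) ⊛ h) n   ≡⟨ cong -_ (⊛-scaleˡ (signQ k) (powS h k) h n) ⟩
      - (signQ k * powS h (suc k) n)          ≡⟨ neg-distribˡ-* (signQ k) (powS h (suc k) n) ⟩
      signQ (suc k) * powS h (suc k) n        ∎

    θ-logTerm : ∀ k → θ (logTerm (suc k)) ≈ (powS (negS h) k ⊛ θ h)
    θ-logTerm k n = begin
      ℕ→ℚ n * (c * powS h (suc k) n)                  ≡⟨ solve 3 (λ a b x → a :* (b :* x) := b :* (a :* x))
                                                                 refl (ℕ→ℚ n) c (powS h (suc k) n) ⟩
      c * θ (powS h (suc k)) n                        ≡⟨ cong (c *_) (θ-powS h k n) ⟩
      c * (ℕ→ℚ (suc k) * (powS h k ⊛ θ h) n)          ≡⟨ sym (*-assoc c _ _) ⟩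
      (c * ℕ→ℚ (suc k)) * (powS h k ⊛ θ h) n          ≡⟨ cong (_* (powS h k ⊛ θ h) n) c·[1+k]≡ ⟩
      signQ k * (powS h k ⊛ θ h) n                    ≡⟨ sym (⊛-scaleˡ (signQ k) (powS h k) (θ h) n) ⟩
      (scaleS (signQ k) (powS h k) ⊛ θ h) n           ≡⟨ ⊛-congˡ (θ h) (≈-sym (powS-negS k)) n ⟩
      (powS (negS h) k ⊛ θ h) n                       ∎
      where
      c = signQ (suc (suc k)) * recipℕ (suc k)
      c·[1+k]≡ : c * ℕ→ℚ (suc k) ≡ signQ k
      c·[1+k]≡ = begin
        (- - signQ k) * recipℕ (suc k) * ℕ→ℚ (suc k)   ≡⟨ *-assoc (- - signQ k) _ _ ⟩
        (- - signQ k) * (recipℕ (suc k) * ℕ→ℚ (suc k)) ≡⟨ cong₂ _*_ (neg-involutive (signQ k)) (recipℕ-inverseˡ k) ⟩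
        signQ k * 1ℚ                                   ≡⟨ *-identityʳ _ ⟩
        signQ k                                        ∎

    θ-logTrunc : ∀ M → θ (logTrunc (suc M)) ≈ (geomSum (negS h) M ⊛ θ h)
    θ-logTrunc zero n = begin
      ℕ→ℚ n * (0ℚ * oneS n + 1ℚ * (oneS ⊛ h) n) ≡⟨ cong (ℕ→ℚ n *_)
                                                       (cong₂ _+_ (*-zeroˡ (oneS n)) (*-identityˡ ((oneS ⊛ h) n))) ⟩
      ℕ→ℚ n * (0ℚ + (oneS ⊛ h) n)               ≡⟨ cong (ℕ→ℚ n *_) (trans (+-identityˡ _) (⊛-identityˡ h n)) ⟩
      θ h n                                     ≡⟨ sym (⊛-identityˡ (θ h) n) ⟩
      (oneS ⊛ θ h) n                            ∎
    θ-logTrunc (suc M) n = begin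
      ℕ→ℚ n * (logTrunc (suc M) n + logTerm (suc (suc M)) n)
        ≡⟨ *-distribˡ-+ (ℕ→ℚ n) _ _ ⟩
      θ (logTrunc (suc M)) n + θ (logTerm (suc (suc M))) n
        ≡⟨ cong₂ _+_ (θ-logTrunc M n) (θ-logTerm (suc M) n) ⟩
      (geomSum (negS h) M ⊛ θ h) n + (powS (negS h) (suc M) ⊛ θ h) n
        ≡⟨ sym (⊛-distribʳ-⊕ (geomSum (negS h) M) (powS (negS h) (suc M)) (θ h) n) ⟩
      (geomSum (negS h) (suc M) ⊛ θ h) n ∎

    θh≈θf : θ h ≈ θ f
    θh≈θf zero    = trans (*-zeroˡ (h 0)) (sym (*-zeroˡ (f 0)))
    θh≈θf (suc n) = cong (ℕ→ℚ (suc n) *_) (+-identityʳ (f (suc n)))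

  -- Truncating log f = Σ_k (-1)^(k+1)/k (f - 1)^k at k ≤ n + 1 leaves coefficient n unchanged,
  -- and θ of the truncation is θ f · Σ_{k ≤ n} (1 - f)^k = θ f / f + O(q^(n+1)).
  logDeriv-logS : LogDeriv f (θ (logS f))
  logDeriv-logS = logDeriv λ n → sym (begin
    (θ (logS f) ⊛ f) n
      ≡⟨ ⊛-cong-upTo n (λ i i≤n → cong (ℕ→ℚ i *_)
             (sym (sumTo-coeff-truncate _ logTerm-vanishesBelow (ℕₚ.m≤n⇒m≤1+n i≤n))))
                     (λ j _ → refl {x = f j}) ⟩
    (θ (logTrunc (suc n)) ⊛ f) n
      ≡⟨ ⊛-congˡ f (θ-logTrunc n) n ⟩
    ((geomSum (negS h) n ⊛ θ h) ⊛ f) n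
      ≡⟨ trans (⊛-congˡ f (⊛-comm (geomSum (negS h) n) (θ h)) n) (⊛-assoc (θ h) (geomSum (negS h) n) f n) ⟩
    (θ h ⊛ (geomSum (negS h) n ⊛ f)) n
      ≡⟨ ⊛-congʳ (θ h) (≈-trans (⊛-congʳ (geomSum (negS h) n) f≈1+h) (geomSum-telescope (negS h) n)) n ⟩
    (θ h ⊛ (oneS ⊖ powS (negS h) (suc n))) n
      ≡⟨ ⊛-oneS-⊖ʳ (θ h) (powS (negS h) (suc n)) n ⟩
    θ h n - (θ h ⊛ powS (negS h) (suc n)) n
      ≡⟨ cong (λ z → θ h n - z)
              (⊛-vanishesBelow 0 (suc n) {θ h} (λ _ ()) (powS-vanishesBelow (negS h) -h₀ (suc n)) n ℕₚ.≤-refl) ⟩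
    θ h n - 0ℚ
      ≡⟨ trans (+-identityʳ (θ h n)) (θh≈θf n) ⟩
    θ f n ∎)
    where
    f≈1+h : f ≈ (oneS ⊖ negS h)
    f≈1+h n = solve 2 (λ x o → x := o :- (:- (x :- o))) refl (f n) (oneS n)

θ-logS : ∀ f {a} → f 0 ≡ 1ℚ → LogDeriv f a → θ (logS f) ≈ a
θ-logS f f₀ l = logDeriv-unique f f₀ (logDeriv-logS f f₀) l

divExact-dvd : ∀ k n → suc k ∣ n → divExact (suc k) n ≡ just (n ℕ./ suc k)
divExact-dvd k n = if-dec-yes (suc k ∣? n)

divExact-∤ : ∀ k n → ¬ (suc k ∣ n) → divExact (suc k) n ≡ nothing
divExact-∤ k n = if-dec-no (suc k ∣? n)

divExact-* : ∀ k m → divExact (suc k) (m ℕ.* suc k) ≡ just m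
divExact-* k m = trans (divExact-dvd k (m ℕ.* suc k) (n∣m*n m)) (cong just (m*n/n≡m m (suc k)))

subPow-* : ∀ k F m → subPow (suc k) F (m ℕ.* suc k) ≡ F m
subPow-* k F m rewrite divExact-* k m = refl

subPow-∤ : ∀ k F n → ¬ (suc k ∣ n) → subPow (suc k) F n ≡ 0ℚ
subPow-∤ k F n k+1∤n rewrite divExact-∤ k n k+1∤n = refl

geomQ-* : ∀ k m → geomQ (suc k) (m ℕ.* suc k) ≡ 1ℚ
geomQ-* k m rewrite divExact-* k m = refl

geomQ-dvd : ∀ k n → suc k ∣ n → geomQ (suc k) n ≡ 1ℚ
geomQ-dvd k .(m ℕ.* suc k) (divides-refl m) = geomQ-* k m

geomQ-∤ : ∀ k n → ¬ (suc k ∣ n) → geomQ (suc k) n ≡ 0ℚ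
geomQ-∤ k n k+1∤n rewrite divExact-∤ k n k+1∤n = refl

sumTo-subPow : ∀ k (F : ℕ → ℚ) m j → j ≤ k → sumTo (m ℕ.* suc k ℕ.+ j) (subPow (suc k) F) ≡ sumTo m F
sumTo-subPow k F zero zero _ = subPow-* k F 0
sumTo-subPow k F (suc m) zero _ = begin
  sumTo ((suc m) ℕ.* suc k ℕ.+ 0) (subPow (suc k) F)
    ≡⟨ cong (λ z → sumTo z (subPow (suc k) F)) last≡ ⟩
  sumTo (m ℕ.* suc k ℕ.+ k) (subPow (suc k) F) + subPow (suc k) F (suc (m ℕ.* suc k ℕ.+ k))
    ≡⟨ cong₂ _+_ (sumTo-subPow k F m k ℕₚ.≤-refl)
                 (trans (cong (subPow (suc k) F) (trans (sym last≡) (ℕₚ.+-identityʳ _))) (subPow-* k F (suc m))) ⟩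
  sumTo m F + F (suc m) ∎
  where
  last≡ : suc m ℕ.* suc k ℕ.+ 0 ≡ suc (m ℕ.* suc k ℕ.+ k)
  last≡ = trans (ℕₚ.+-identityʳ _) (cong suc (ℕₚ.+-comm k (m ℕ.* suc k)))
sumTo-subPow k F m (suc j) 1+j≤k = begin
  sumTo (m ℕ.* suc k ℕ.+ suc j) (subPow (suc k) F)
    ≡⟨ cong (λ z → sumTo z (subPow (suc k) F)) (ℕₚ.+-suc (m ℕ.* suc k) j) ⟩
  sumTo (m ℕ.* suc k ℕ.+ j) (subPow (suc k) F) + subPow (suc k) F (suc (m ℕ.* suc k ℕ.+ j))
    ≡⟨ cong₂ _+_ (sumTo-subPow k F m j (ℕₚ.<⇒≤ 1+j≤k)) (subPow-∤ k F _ k+1∤) ⟩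
  sumTo m F + 0ℚ
    ≡⟨ +-identityʳ _ ⟩
  sumTo m F ∎
  where
  k+1∤ : ¬ (suc k ∣ suc (m ℕ.* suc k ℕ.+ j))
  k+1∤ k+1∣ = >⇒∤ (s≤s 1+j≤k) (∣m+n∣m⇒∣n (subst (suc k ∣_) (sym (ℕₚ.+-suc (m ℕ.* suc k) j)) k+1∣) (n∣m*n m))

subPow-cong : ∀ p {f g} → f ≈ g → subPow p f ≈ subPow p g
subPow-cong p f≈g n with divExact p n
... | just m  = f≈g m
... | nothing = refl

subPow-⊛ : ∀ k f g → subPow (suc k) (f ⊛ g) ≈ (subPow (suc k) f ⊛ subPow (suc k) g)
subPow-⊛ k f g n with suc k ∣? n
... | yes (divides-refl q) = sym (begin
  sumTo (q ℕ.* p) (λ i → subPow p f i * subPow p g (q ℕ.* p ∸ i))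
    ≡⟨ sumTo-cong (q ℕ.* p) term≡ ⟩
  sumTo (q ℕ.* p) (subPow p H)
    ≡⟨ cong (λ z → sumTo z (subPow p H)) (sym (ℕₚ.+-identityʳ (q ℕ.* p))) ⟩
  sumTo (q ℕ.* p ℕ.+ 0) (subPow p H)
    ≡⟨ sumTo-subPow k H q 0 z≤n ⟩
  (f ⊛ g) q
    ≡⟨ sym (subPow-* k (f ⊛ g) q) ⟩
  subPow p (f ⊛ g) (q ℕ.* p) ∎)
  where
  p = suc k
  H : ℕ → ℚ
  H j = f j * g (q ∸ j)
  term≡ : ∀ i → i ≤ q ℕ.* p → subPow p f i * subPow p g (q ℕ.* p ∸ i) ≡ subPow p H i
  term≡ i _ with p ∣? i
  ... | yes (divides-refl j) = begin
    subPow p f (j ℕ.* p) * subPow p g (q ℕ.* p ∸ j ℕ.* p)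
      ≡⟨ cong₂ _*_ (subPow-* k f j) (trans (cong (subPow p g) (sym (ℕₚ.*-distribʳ-∸ p q j))) (subPow-* k g (q ∸ j))) ⟩
    H j
      ≡⟨ sym (subPow-* k H j) ⟩
    subPow p H (j ℕ.* p) ∎
  ... | no p∤i = trans (cong (_* subPow p g (q ℕ.* p ∸ i)) (subPow-∤ k f i p∤i))
                       (trans (*-zeroˡ (subPow p g (q ℕ.* p ∸ i))) (sym (subPow-∤ k H i p∤i)))
... | no p∤n = begin
  subPow (suc k) (f ⊛ g) n                  ≡⟨ subPow-∤ k (f ⊛ g) n p∤n ⟩
  0ℚ                                        ≡⟨ sym (sumTo-zero n term≡0) ⟩
  (subPow (suc k) f ⊛ subPow (suc k) g) n   ∎
  where
  term≡0 : ∀ i → i ≤ n → subPow (suc k) f i * subPow (suc k) g (n ∸ i) ≡ 0ℚ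
  term≡0 i i≤n with suc k ∣? i
  ... | no p∤i  = trans (cong (_* subPow (suc k) g (n ∸ i)) (subPow-∤ k f i p∤i)) (*-zeroˡ (subPow (suc k) g (n ∸ i)))
  ... | yes p∣i = trans (cong (subPow (suc k) f i *_) (subPow-∤ k g (n ∸ i) p∤n∸i)) (*-zeroʳ (subPow (suc k) f i))
    where
    p∤n∸i : ¬ (suc k ∣ n ∸ i)
    p∤n∸i p∣n∸i = p∤n (subst (suc k ∣_) (ℕₚ.m+[n∸m]≡n i≤n) (∣m∣n⇒∣m+n p∣i p∣n∸i))

θ-subPow : ∀ k f → θ (subPow (suc k) f) ≈ scaleS (ℕ→ℚ (suc k)) (subPow (suc k) (θ f))
θ-subPow k f n with suc k ∣? n
... | yes (divides-refl q) = begin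
  ℕ→ℚ (q ℕ.* suc k) * subPow (suc k) f (q ℕ.* suc k)  ≡⟨ cong₂ _*_ (ℕ→ℚ-* q (suc k)) (subPow-* k f q) ⟩
  ℕ→ℚ q * ℕ→ℚ (suc k) * f q                           ≡⟨ solve 3 (λ a b x → a :* b :* x := b :* (a :* x)) refl
                                                                  (ℕ→ℚ q) (ℕ→ℚ (suc k)) (f q) ⟩
  ℕ→ℚ (suc k) * (ℕ→ℚ q * f q)                         ≡⟨ cong (ℕ→ℚ (suc k) *_) (sym (subPow-* k (θ f) q)) ⟩
  ℕ→ℚ (suc k) * subPow (suc k) (θ f) (q ℕ.* suc k)    ∎
... | no p∤n = begin
  ℕ→ℚ n * subPow (suc k) f n                 ≡⟨ cong (ℕ→ℚ n *_) (subPow-∤ k f n p∤n) ⟩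
  ℕ→ℚ n * 0ℚ                                 ≡⟨ *-zeroʳ (ℕ→ℚ n) ⟩
  0ℚ                                         ≡⟨ sym (*-zeroʳ (ℕ→ℚ (suc k))) ⟩
  ℕ→ℚ (suc k) * 0ℚ                           ≡⟨ cong (ℕ→ℚ (suc k) *_) (sym (subPow-∤ k (θ f) n p∤n)) ⟩
  ℕ→ℚ (suc k) * subPow (suc k) (θ f) n       ∎

logDeriv-subPow : ∀ k {f a} → LogDeriv f a → LogDeriv (subPow (suc k) f) (scaleS (ℕ→ℚ (suc k)) (subPow (suc k) a))
logDeriv-subPow k {f} {a} (logDeriv l) = logDeriv λ n → begin
  θ (subPow p f) n                      ≡⟨ θ-subPow k f n ⟩
  ℕ→ℚ p * subPow p (θ f) n              ≡⟨ cong (ℕ→ℚ p *_) (subPow-cong p l n) ⟩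
  ℕ→ℚ p * subPow p (a ⊛ f) n            ≡⟨ cong (ℕ→ℚ p *_) (subPow-⊛ k a f n) ⟩
  ℕ→ℚ p * (subPow p a ⊛ subPow p f) n   ≡⟨ sym (⊛-scaleˡ (ℕ→ℚ p) (subPow p a) (subPow p f) n) ⟩
  (scaleS (ℕ→ℚ p) (subPow p a) ⊛ subPow p f) n ∎
  where
  p = suc k

-- The logarithmic derivative of the product P

monomial : ℕ → PS
monomial j n = if does (n ℕ.≟ j) then 1ℚ else 0ℚ

monomial-⊛-≤ : ∀ j f n → j ≤ n → (monomial j ⊛ f) n ≡ f (n ∸ j)
monomial-⊛-≤ j f n j≤n = begin
  (monomial j ⊛ f) n         ≡⟨ sumTo-single n j j≤n (λ i _ i≢j → trans (cong (_* f (n ∸ i)) (if-dec-no (i ℕ.≟ j) i≢j))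
                                                                     (*-zeroˡ (f (n ∸ i)))) ⟩
  monomial j j * f (n ∸ j)   ≡⟨ cong (_* f (n ∸ j)) (if-dec-yes (j ℕ.≟ j) refl) ⟩
  1ℚ * f (n ∸ j)             ≡⟨ *-identityˡ (f (n ∸ j)) ⟩
  f (n ∸ j)                  ∎

monomial-⊛-< : ∀ j f n → n < j → (monomial j ⊛ f) n ≡ 0ℚ
monomial-⊛-< j f n n<j = sumTo-zero n (λ i i≤n →
  trans (cong (_* f (n ∸ i)) (if-dec-no (i ℕ.≟ j) (ℕₚ.<⇒≢ (ℕₚ.≤-<-trans i≤n n<j)))) (*-zeroˡ (f (n ∸ i))))

θ-monomial : ∀ j → θ (monomial j) ≈ scaleS (ℕ→ℚ j) (monomial j)
θ-monomial j n with n ℕ.≟ j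
... | yes refl = refl
... | no  n≢j  = begin
  ℕ→ℚ n * monomial j n ≡⟨ cong (ℕ→ℚ n *_) (if-dec-no (n ℕ.≟ j) n≢j) ⟩
  ℕ→ℚ n * 0ℚ           ≡⟨ *-zeroʳ (ℕ→ℚ n) ⟩
  0ℚ                   ≡⟨ sym (*-zeroʳ (ℕ→ℚ j)) ⟩
  ℕ→ℚ j * 0ℚ           ≡⟨ cong (ℕ→ℚ j *_) (sym (if-dec-no (n ℕ.≟ j) n≢j)) ⟩
  ℕ→ℚ j * monomial j n ∎

geomQ-shift : ∀ k n → suc k ≤ n → geomQ (suc k) n ≡ geomQ (suc k) (n ∸ suc k)
geomQ-shift k n k<n with suc k ∣? (n ∸ suc k)
... | yes p∣n-p = trans (geomQ-dvd k n (∣m∸n∣n⇒∣m (suc k) k<n p∣n-p ∣-refl)) (sym (geomQ-dvd k (n ∸ suc k) p∣n-p))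
... | no  p∤n-p = trans (geomQ-∤ k n p∤n) (sym (geomQ-∤ k (n ∸ suc k) p∤n-p))
  where
  p∤n : ¬ (suc k ∣ n)
  p∤n p∣n = p∤n-p (∣m+n∣m⇒∣n (subst (suc k ∣_) (sym (ℕₚ.m+[n∸m]≡n k<n)) p∣n) ∣-refl)

geomQ-inverse : ∀ k → (geomQ (suc k) ⊛ (oneS ⊖ monomial (suc k))) ≈ oneS
geomQ-inverse k n = begin
  (G ⊛ (oneS ⊖ monomial (suc k))) n   ≡⟨ ⊛-oneS-⊖ʳ G (monomial (suc k)) n ⟩
  G n - (G ⊛ monomial (suc k)) n      ≡⟨ cong (λ z → G n - z) (⊛-comm G (monomial (suc k)) n) ⟩
  G n - (monomial (suc k) ⊛ G) n      ≡⟨ telescoped n ⟩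
  oneS n                              ∎
  where
  G = geomQ (suc k)
  telescoped : ∀ n → G n - (monomial (suc k) ⊛ G) n ≡ oneS n
  telescoped zero = cong₂ _-_ (geomQ-* k 0) (monomial-⊛-< (suc k) G 0 (s≤s z≤n))
  telescoped (suc n) with suc k ℕ.≤? suc n
  ... | yes k<n = trans (cong₂ _-_ (geomQ-shift k (suc n) k<n) (monomial-⊛-≤ (suc k) G (suc n) k<n))
                        (+-inverseʳ (G (suc n ∸ suc k)))
  ... | no  k≮n = cong₂ _-_ (geomQ-∤ k (suc n) (>⇒∤ (ℕₚ.≰⇒> k≮n)))
                            (monomial-⊛-< (suc k) G (suc n) (ℕₚ.≰⇒> k≮n))

divisorSeries : ℕ → PS
divisorSeries j = scaleS (ℕ→ℚ j) (geomQ j ⊖ oneS)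

logDeriv-oneMinusQ : ∀ k → LogDeriv (oneS ⊖ monomial (suc k)) (negS (divisorSeries (suc k)))
logDeriv-oneMinusQ k = logDeriv λ n → begin
  ℕ→ℚ n * (oneS n - monomial j n)
    ≡⟨ solve 3 (λ a o m → a :* (o :- m) := a :* o :- a :* m) refl (ℕ→ℚ n) (oneS n) (monomial j n) ⟩
  θ oneS n - θ (monomial j) n
    ≡⟨ cong₂ _-_ (θ-oneS n) (θ-monomial j n) ⟩
  0ℚ - ℕ→ℚ j * monomial j n
    ≡⟨ cong (λ z → 0ℚ - ℕ→ℚ j * z) (solve 2 (λ m x → m := x :- (x :- m)) refl (monomial j n) (oneS n)) ⟩
  0ℚ - ℕ→ℚ j * (oneS n - X n)
    ≡⟨ cong (λ z → 0ℚ - ℕ→ℚ j * (z - X n)) (sym (geomQ-inverse k n)) ⟩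
  0ℚ - ℕ→ℚ j * ((geomQ j ⊛ X) n - X n)
    ≡⟨ cong (λ z → 0ℚ - ℕ→ℚ j * ((geomQ j ⊛ X) n + z)) (sym (trans (⊛-negˡ oneS X n) (cong -_ (⊛-identityˡ X n)))) ⟩
  0ℚ - ℕ→ℚ j * ((geomQ j ⊛ X) n + (negS oneS ⊛ X) n)
    ≡⟨ cong (λ z → 0ℚ - ℕ→ℚ j * z) (sym (⊛-distribʳ-⊕ (geomQ j) (negS oneS) X n)) ⟩
  0ℚ - ℕ→ℚ j * ((geomQ j ⊖ oneS) ⊛ X) n
    ≡⟨ trans (+-identityˡ _) (cong -_ (sym (⊛-scaleˡ (ℕ→ℚ j) (geomQ j ⊖ oneS) X n))) ⟩
  - (divisorSeries j ⊛ X) n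
    ≡⟨ sym (⊛-negˡ (divisorSeries j) X n) ⟩
  (negS (divisorSeries j) ⊛ X) n ∎
  where
  j = suc k
  X = oneS ⊖ monomial j

logDeriv-geomQ : ∀ k → LogDeriv (geomQ (suc k)) (divisorSeries (suc k))
logDeriv-geomQ k = logDeriv-cong (λ _ → refl) (λ n → neg-involutive (divisorSeries (suc k) n))
  (logDeriv-inverse (geomQ-inverse k) refl (logDeriv-oneMinusQ k))

oneMinusQ3≈ : ∀ m → oneMinusQ3 (suc m) ≈ (oneS ⊖ monomial (3 ℕ.* suc m))
oneMinusQ3≈ m zero = refl
oneMinusQ3≈ m (suc n) with suc n ℕ.≟ 3 ℕ.* suc m
... | yes n≡3m = trans (if-dec-yes (suc n ℕ.≟ 3 ℕ.* suc m) n≡3m)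
                       (cong (λ z → 0ℚ - z) (sym (if-dec-yes (suc n ℕ.≟ 3 ℕ.* suc m) n≡3m)))
... | no  n≢3m = trans (if-dec-no (suc n ℕ.≟ 3 ℕ.* suc m) n≢3m)
                       (cong (λ z → 0ℚ - z) (sym (if-dec-no (suc n ℕ.≟ 3 ℕ.* suc m) n≢3m)))

factorLogDeriv : ℕ → PS
factorLogDeriv m = scaleS (ℕ→ℚ 12) (negS (divisorSeries (3 ℕ.* m))) ⊕ scaleS (ℕ→ℚ 12) (divisorSeries m)

logDeriv-factor : ∀ m → LogDeriv (factor (suc m)) (factorLogDeriv (suc m))
logDeriv-factor m = logDeriv-⊛
  (logDeriv-powS (logDeriv-cong (≈-sym (oneMinusQ3≈ m)) (λ _ → refl) (logDeriv-oneMinusQ (m ℕ.+ 2 ℕ.* suc m))) 12)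
  (logDeriv-powS (logDeriv-geomQ m) 12)

prodLogDeriv : ℕ → PS
prodLogDeriv N n = sumTo N (λ m → factorLogDeriv m n)

logDeriv-prodUpTo : ∀ N → LogDeriv (prodUpTo N) (prodLogDeriv N)
logDeriv-prodUpTo zero    = logDeriv-cong (λ _ → refl) (λ n → sym (factorLogDeriv-0 n)) logDeriv-oneS
  where
  factorLogDeriv-0 : ∀ n → factorLogDeriv 0 n ≡ 0ℚ
  factorLogDeriv-0 n = cong₂ (λ x y → ℕ→ℚ 12 * - x + ℕ→ℚ 12 * y)
                             (*-zeroˡ ((geomQ 0 ⊖ oneS) n)) (*-zeroˡ ((geomQ 0 ⊖ oneS) n))
logDeriv-prodUpTo (suc N) = logDeriv-⊛ (logDeriv-prodUpTo N) (logDeriv-factor N)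

oneMinusQ3-isOneBelow : ∀ m → IsOneBelow m (oneMinusQ3 m)
oneMinusQ3-isOneBelow m zero    _    = refl
oneMinusQ3-isOneBelow m (suc n) n<m  = if-dec-no (suc n ℕ.≟ 3 ℕ.* m)
  (λ n≡3m → ℕₚ.<⇒≱ n<m (subst (m ≤_) (sym n≡3m) (ℕₚ.m≤n*m m 3)))

geomQ-isOneBelow : ∀ k → IsOneBelow (suc k) (geomQ (suc k))
geomQ-isOneBelow k zero    _     = geomQ-* k 0
geomQ-isOneBelow k (suc n) n<k+1 = geomQ-∤ k (suc n) (>⇒∤ n<k+1)

factor-isOneBelow : ∀ k → IsOneBelow (suc k) (factor (suc k))
factor-isOneBelow k = ⊛-isOneBelow (suc k) (powS-isOneBelow (suc k) (oneMinusQ3-isOneBelow (suc k)) 12)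
                                           (powS-isOneBelow (suc k) (geomQ-isOneBelow k) 12)

prodUpTo-stable : ∀ {N n} → n ≤ N → prodUpTo N n ≡ prodUpTo n n
prodUpTo-stable {zero} z≤n = refl
prodUpTo-stable {suc N} {n} n≤N+1 with ℕₚ.m≤n⇒m<n∨m≡n n≤N+1
... | inj₂ refl        = refl
... | inj₁ (s≤s n≤N) = trans (⊛-isOneBelowʳ (suc N) (prodUpTo N) (factor-isOneBelow N) n (s≤s n≤N))
                              (prodUpTo-stable n≤N)

divisorSeries-vanishesBelow : ∀ k → VanishesBelow (suc k) (divisorSeries (suc k))
divisorSeries-vanishesBelow k n n<k+1 =
  trans (cong (λ z → ℕ→ℚ (suc k) * (z - oneS n)) (geomQ-isOneBelow k n n<k+1))
        (trans (cong (ℕ→ℚ (suc k) *_) (+-inverseʳ (oneS n))) (*-zeroʳ (ℕ→ℚ (suc k))))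

factorLogDeriv-vanishesBelow : ∀ k → VanishesBelow (suc k) (factorLogDeriv (suc k))
factorLogDeriv-vanishesBelow k n n<k+1 =
  cong₂ (λ x y → ℕ→ℚ 12 * - x + ℕ→ℚ 12 * y)
        (divisorSeries-vanishesBelow (k ℕ.+ 2 ℕ.* suc k) n (ℕₚ.<-≤-trans n<k+1 (ℕₚ.m≤n*m (suc k) 3)))
        (divisorSeries-vanishesBelow k n n<k+1)

prodLogDeriv-stable : ∀ {N n} → n ≤ N → prodLogDeriv N n ≡ prodLogDeriv n n
prodLogDeriv-stable {N} {n} n≤N = sumTo-extend n≤N vanishing
  where
  vanishing : ∀ m → n < m → m ≤ N → factorLogDeriv m n ≡ 0ℚ
  vanishing (suc k) n<k+1 _ = factorLogDeriv-vanishesBelow k n n<k+1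

PLogDeriv : PS
PLogDeriv n = prodLogDeriv n n

logDeriv-Pser : LogDeriv Pser PLogDeriv
logDeriv-Pser = logDeriv λ n → begin
  ℕ→ℚ n * prodUpTo n n         ≡⟨ θ≈a⊛f (logDeriv-prodUpTo n) n ⟩
  (prodLogDeriv n ⊛ prodUpTo n) n ≡⟨ ⊛-cong-upTo n (λ _ → prodLogDeriv-stable) (λ _ → prodUpTo-stable) ⟩
  (PLogDeriv ⊛ Pser) n          ∎

quotLogDeriv : ℕ → PS
quotLogDeriv p = scaleS (ℕ→ℚ p) PLogDeriv ⊖ scaleS (ℕ→ℚ p) (subPow p PLogDeriv)

logDeriv-quotSer : ∀ k → LogDeriv (quotSer (suc k)) (quotLogDeriv (suc k))
logDeriv-quotSer k = logDeriv-⊛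
  (logDeriv-powS logDeriv-Pser p)
  (logDeriv-inverse {g = invS (subPow p Pser)}
    (invS-inverseˡ (subPow p Pser) (subPow-* k Pser 0)) (subPow-* k Pser 0) (logDeriv-subPow k logDeriv-Pser))
  where
  p = suc k

θ-U : ∀ k → θ (U (suc k)) ≈ quotLogDeriv (suc k)
θ-U k = θ-logS (quotSer (suc k)) quotSer₀ (logDeriv-quotSer k)
  where
  quotSer₀ : quotSer (suc k) 0 ≡ 1ℚ
  quotSer₀ = trans (cong (_* 1ℚ) (powS-zero-coeff Pser (suc k) refl)) (*-identityˡ 1ℚ)

divisorTerm recipDivisorTerm : ℕ → ℕ → ℚ
divisorTerm d n = if does (d ∣? n) then ℕ→ℚ d else 0ℚ
recipDivisorTerm d n = if does (d ∣? n) then recipℕ d else 0ℚ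

σ₁ : ℕ → ℚ
σ₁ n = sumTo n (λ d → divisorTerm d n)

cofactorTerm : ℕ → ℕ → ℕ → ℚ
cofactorTerm N d e = if does (d ℕ.* e ℕ.≟ N) then ℕ→ℚ e else 0ℚ

*-recipDivisorTerm : ∀ n d → ℕ→ℚ (suc n) * recipDivisorTerm d (suc n) ≡ sumTo (suc n) (cofactorTerm (suc n) d)
*-recipDivisorTerm n d with d ∣? suc n
... | no  d∤N = trans (*-zeroʳ (ℕ→ℚ (suc n)))
  (sym (sumTo-no-solution (suc n) (d ℕ.*_) ℕ→ℚ (λ e de≡N → d∤N (divides e (trans (sym de≡N) (ℕₚ.*-comm d e))))))
... | yes (divides zero N≡0) = contradiction N≡0 (λ ())
... | yes (divides (suc e′) N≡e·d) with d
...   | zero   = contradiction (trans N≡e·d (ℕₚ.*-zeroʳ (suc e′))) (λ ())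
...   | suc d′ = sym (trans (sumTo-unique-solution (suc n) (suc d′ ℕ.*_) ℕ→ℚ e e≤N unique
                               (trans (ℕₚ.*-comm (suc d′) e) (sym N≡e·d)))
                            (sym N/d≡e))
  where
  e = suc e′
  e≤N : e ≤ suc n
  e≤N = subst (e ≤_) (sym N≡e·d) (ℕₚ.m≤m*n e (suc d′))
  unique : ∀ b → suc d′ ℕ.* b ≡ suc n → b ≡ e
  unique b d·b≡N = ℕₚ.*-cancelˡ-≡ b e (suc d′) (trans d·b≡N (trans N≡e·d (ℕₚ.*-comm e (suc d′))))
  N/d≡e : ℕ→ℚ (suc n) * recipℕ (suc d′) ≡ ℕ→ℚ e
  N/d≡e = begin
    ℕ→ℚ (suc n) * recipℕ (suc d′)             ≡⟨ cong (λ z → ℕ→ℚ z * recipℕ (suc d′)) N≡e·d ⟩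
    ℕ→ℚ (e ℕ.* suc d′) * recipℕ (suc d′)      ≡⟨ cong (_* recipℕ (suc d′)) (ℕ→ℚ-* e (suc d′)) ⟩
    ℕ→ℚ e * ℕ→ℚ (suc d′) * recipℕ (suc d′)    ≡⟨ solve 3 (λ a b c → a :* b :* c := a :* (c :* b)) refl
                                                           (ℕ→ℚ e) (ℕ→ℚ (suc d′)) (recipℕ (suc d′)) ⟩
    ℕ→ℚ e * (recipℕ (suc d′) * ℕ→ℚ (suc d′))  ≡⟨ cong (ℕ→ℚ e *_) (recipℕ-inverseˡ d′) ⟩
    ℕ→ℚ e * 1ℚ                                ≡⟨ *-identityʳ _ ⟩
    ℕ→ℚ e                                     ∎

sumTo-cofactorTerm : ∀ n e → sumTo (suc n) (λ d → cofactorTerm (suc n) d e) ≡ divisorTerm e (suc n)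
sumTo-cofactorTerm n e with e ∣? suc n
... | no  e∤N = sumTo-no-solution (suc n) (ℕ._* e) (λ _ → ℕ→ℚ e) (λ d de≡N → e∤N (divides d (sym de≡N)))
... | yes (divides d N≡d·e) with e
...   | zero   = contradiction (trans N≡d·e (ℕₚ.*-zeroʳ d)) (λ ())
...   | suc e′ = sumTo-unique-solution (suc n) (ℕ._* suc e′) (λ _ → ℕ→ℚ (suc e′)) d
                   (subst (d ≤_) (sym N≡d·e) (ℕₚ.m≤m*n d (suc e′)))
                   (λ b b·e≡N → ℕₚ.*-cancelʳ-≡ b d (suc e′) (trans b·e≡N N≡d·e)) (sym N≡d·e)

-- Both sides count the factorisations d · e = n + 1, weighted by e.
*-σ₋₁≡σ₁ : ∀ n → ℕ→ℚ (suc n) * σ₋₁ (suc n) ≡ σ₁ (suc n)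
*-σ₋₁≡σ₁ n = begin
  ℕ→ℚ N * σ₋₁ N                                    ≡⟨ sym (sumTo-*ˡ N (ℕ→ℚ N) _) ⟩
  sumTo N (λ d → ℕ→ℚ N * recipDivisorTerm d N)     ≡⟨ sumTo-cong N (λ d _ → *-recipDivisorTerm n d) ⟩
  sumTo N (λ d → sumTo N (cofactorTerm N d))       ≡⟨ sumTo-comm N N (cofactorTerm N) ⟩
  sumTo N (λ e → sumTo N (λ d → cofactorTerm N d e)) ≡⟨ sumTo-cong N (λ e _ → sumTo-cofactorTerm n e) ⟩
  σ₁ N                                             ∎
  where N = suc n

σ₋₁div-* : ∀ k t → σ₋₁div (t ℕ.* suc k) (suc k) ≡ σ₋₁ t
σ₋₁div-* k t rewrite divExact-* k t = refl

σ₋₁div-∤ : ∀ k n → ¬ (suc k ∣ n) → σ₋₁div n (suc k) ≡ 0ℚ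
σ₋₁div-∤ k n k+1∤n rewrite divExact-∤ k n k+1∤n = refl

lamDiv-* : ∀ k t → lamDiv (t ℕ.* suc k) (suc k) ≡ lam t
lamDiv-* k t rewrite divExact-* k t = refl

lamDiv-∤ : ∀ k n → ¬ (suc k ∣ n) → lamDiv n (suc k) ≡ 0ℚ
lamDiv-∤ k n k+1∤n rewrite divExact-∤ k n k+1∤n = refl

divisorSeries-coeff : ∀ m n → divisorSeries m (suc n) ≡ divisorTerm m (suc n)
divisorSeries-coeff zero n =
  trans (*-zeroˡ ((geomQ 0 ⊖ oneS) (suc n)))
        (sym (if-dec-no (0 ∣? suc n) {x = ℕ→ℚ 0} (λ 0∣N → contradiction (0∣⇒≡0 0∣N) (λ ()))))
divisorSeries-coeff (suc k) n with suc k ∣? suc n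
... | yes k+1∣N = trans (cong (λ z → ℕ→ℚ (suc k) * (z - 0ℚ)) (geomQ-dvd k (suc n) k+1∣N))
                        (trans (*-identityʳ _) (sym (if-dec-yes (suc k ∣? suc n) k+1∣N)))
... | no  k+1∤N = trans (cong (λ z → ℕ→ℚ (suc k) * (z - 0ℚ)) (geomQ-∤ k (suc n) k+1∤N))
                        (trans (*-zeroʳ (ℕ→ℚ (suc k))) (sym (if-dec-no (suc k ∣? suc n) k+1∤N)))

divisorTerm-3* : ∀ m t → divisorTerm (3 ℕ.* m) (t ℕ.* 3) ≡ ℕ→ℚ 3 * divisorTerm m t
divisorTerm-3* m t with m ∣? t
... | yes m∣t = trans (if-dec-yes (3 ℕ.* m ∣? t ℕ.* 3) (subst (3 ℕ.* m ∣_) (ℕₚ.*-comm 3 t) (*-monoʳ-∣ 3 m∣t)))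
                      (ℕ→ℚ-* 3 m)
... | no  m∤t = trans (if-dec-no (3 ℕ.* m ∣? t ℕ.* 3)
                                (λ 3m∣3t → m∤t (*-cancelˡ-∣ 3 (subst (3 ℕ.* m ∣_) (ℕₚ.*-comm t 3) 3m∣3t))))
                      (sym (*-zeroʳ (ℕ→ℚ 3)))

*-σ₋₁div3 : ∀ n → ℕ→ℚ (suc n) * σ₋₁div (suc n) 3 ≡ sumTo (suc n) (λ m → divisorTerm (3 ℕ.* m) (suc n))
*-σ₋₁div3 n with 3 ∣? suc n
... | yes (divides zero ())
... | yes (divides (suc t) N≡3T) = subst Claim (sym N≡3T) (multiple-of-3 t)
  where
  Claim : ℕ → Set
  Claim N = ℕ→ℚ N * σ₋₁div N 3 ≡ sumTo N (λ m → divisorTerm (3 ℕ.* m) N)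
  multiple-of-3 : ∀ t → Claim (suc t ℕ.* 3)
  multiple-of-3 t = begin
    ℕ→ℚ (T ℕ.* 3) * σ₋₁div (T ℕ.* 3) 3
      ≡⟨ cong₂ _*_ (ℕ→ℚ-* T 3) (σ₋₁div-* 2 T) ⟩
    ℕ→ℚ T * ℕ→ℚ 3 * σ₋₁ T
      ≡⟨ solve 3 (λ a b c → a :* b :* c := b :* (a :* c)) refl (ℕ→ℚ T) (ℕ→ℚ 3) (σ₋₁ T) ⟩
    ℕ→ℚ 3 * (ℕ→ℚ T * σ₋₁ T)
      ≡⟨ cong (ℕ→ℚ 3 *_) (*-σ₋₁≡σ₁ t) ⟩
    ℕ→ℚ 3 * σ₁ T
      ≡⟨ cong (ℕ→ℚ 3 *_) (sym (sumTo-extend (ℕₚ.m≤m*n T 3) (λ m T<m _ → if-dec-no (m ∣? T) (>⇒∤ T<m)))) ⟩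
    ℕ→ℚ 3 * sumTo (T ℕ.* 3) (λ m → divisorTerm m T)
      ≡⟨ sym (sumTo-*ˡ (T ℕ.* 3) (ℕ→ℚ 3) _) ⟩
    sumTo (T ℕ.* 3) (λ m → ℕ→ℚ 3 * divisorTerm m T)
      ≡⟨ sumTo-cong (T ℕ.* 3) (λ m _ → sym (divisorTerm-3* m T)) ⟩
    sumTo (T ℕ.* 3) (λ m → divisorTerm (3 ℕ.* m) (T ℕ.* 3)) ∎
    where T = suc t
... | no 3∤N = begin
  ℕ→ℚ (suc n) * σ₋₁div (suc n) 3     ≡⟨ cong (ℕ→ℚ (suc n) *_) (σ₋₁div-∤ 2 (suc n) 3∤N) ⟩
  ℕ→ℚ (suc n) * 0ℚ                   ≡⟨ *-zeroʳ (ℕ→ℚ (suc n)) ⟩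
  0ℚ                                 ≡⟨ sym (sumTo-zero (suc n) (λ m _ → if-dec-no (3 ℕ.* m ∣? suc n)
                                                                          (λ 3m∣N → 3∤N (m*n∣⇒m∣ 3 m 3m∣N)))) ⟩
  sumTo (suc n) (λ m → divisorTerm (3 ℕ.* m) (suc n)) ∎

PLogDeriv-coeff : ∀ n → PLogDeriv n ≡ ℕ→ℚ 12 * (ℕ→ℚ n * lam n)
PLogDeriv-coeff zero = sym (trans (cong (ℕ→ℚ 12 *_) (*-zeroˡ (lam 0))) (*-zeroʳ (ℕ→ℚ 12)))
PLogDeriv-coeff (suc n) = begin
  sumTo N (λ m → c * - divisorSeries (3 ℕ.* m) N + c * divisorSeries m N)
    ≡⟨ sumTo-cong N (λ m _ → cong₂ (λ x y → c * - x + c * y) (divisorSeries-coeff (3 ℕ.* m) n) (divisorSeries-coeff m n)) ⟩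
  sumTo N (λ m → c * - divisorTerm (3 ℕ.* m) N + c * divisorTerm m N)
    ≡⟨ sumTo-distrib-+ N _ _ ⟩
  sumTo N (λ m → c * - divisorTerm (3 ℕ.* m) N) + sumTo N (λ m → c * divisorTerm m N)
    ≡⟨ cong₂ _+_ (trans (sumTo-cong N (λ m _ → sym (neg-distribʳ-* c (divisorTerm (3 ℕ.* m) N))))
                        (trans (sumTo-neg N _) (cong -_ (sumTo-*ˡ N c _))))
                 (sumTo-*ˡ N c _) ⟩
  - (c * sumTo N (λ m → divisorTerm (3 ℕ.* m) N)) + c * σ₁ N
    ≡⟨ cong₂ (λ x y → - (c * x) + c * y) (sym (*-σ₋₁div3 n)) (sym (*-σ₋₁≡σ₁ n)) ⟩
  - (c * (ℕ→ℚ N * σ₋₁div N 3)) + c * (ℕ→ℚ N * σ₋₁ N)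
    ≡⟨ solve 4 (λ c a x y → :- (c :* (a :* y)) :+ c :* (a :* x) := c :* (a :* (x :- y)))
               refl c (ℕ→ℚ N) (σ₋₁ N) (σ₋₁div N 3) ⟩
  c * (ℕ→ℚ N * lam N) ∎
  where
  N = suc n
  c = ℕ→ℚ 12

Uformula : ℕ → PS
Uformula p n = ℕ→ℚ (12 ℕ.* p) * (lam n - recipℕ p * lamDiv n p)

θ-Uformula-* : ∀ k q → θ (Uformula (suc k)) (q ℕ.* suc k) ≡ quotLogDeriv (suc k) (q ℕ.* suc k)
θ-Uformula-* k q = begin
  ℕ→ℚ (q ℕ.* p) * (ℕ→ℚ (12 ℕ.* p) * (L - r * lamDiv (q ℕ.* p) p))
    ≡⟨ cong₂ (λ a b → a * (b * (L - r * lamDiv (q ℕ.* p) p))) (ℕ→ℚ-* q p) (ℕ→ℚ-* 12 p) ⟩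
  Q * P * (c * P * (L - r * lamDiv (q ℕ.* p) p))
    ≡⟨ cong (λ z → Q * P * (c * P * (L - r * z))) (lamDiv-* k q) ⟩
  Q * P * (c * P * (L - r * L′))
    ≡⟨ solve 6 (λ Q P c L r L′ → Q :* P :* (c :* P :* (L :- r :* L′))
                                := P :* (c :* (Q :* P :* L)) :- P :* (c :* (Q :* L′)) :* (r :* P))
               refl Q P c L r L′ ⟩
  P * (c * (Q * P * L)) - P * (c * (Q * L′)) * (r * P)
    ≡⟨ cong (λ z → P * (c * (Q * P * L)) - P * (c * (Q * L′)) * z) (recipℕ-inverseˡ k) ⟩
  P * (c * (Q * P * L)) - P * (c * (Q * L′)) * 1ℚ
    ≡⟨ cong (λ z → P * (c * (Q * P * L)) - z) (*-identityʳ _) ⟩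
  P * (c * (Q * P * L)) - P * (c * (Q * L′))
    ≡⟨ cong₂ (λ x y → P * x - P * y)
             (trans (cong (λ z → c * (z * L)) (sym (ℕ→ℚ-* q p))) (sym (PLogDeriv-coeff (q ℕ.* p))))
             (trans (sym (PLogDeriv-coeff q)) (sym (subPow-* k PLogDeriv q))) ⟩
  quotLogDeriv p (q ℕ.* p) ∎
  where
  p = suc k
  P = ℕ→ℚ p
  r = recipℕ p
  Q = ℕ→ℚ q
  c = ℕ→ℚ 12
  L = lam (q ℕ.* p)
  L′ = lam q

θ-Uformula-∤ : ∀ k m → ¬ (suc k ∣ m) → θ (Uformula (suc k)) m ≡ quotLogDeriv (suc k) m
θ-Uformula-∤ k m p∤m = begin
  ℕ→ℚ m * (ℕ→ℚ (12 ℕ.* p) * (lam m - r * lamDiv m p))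
    ≡⟨ cong₂ (λ a b → ℕ→ℚ m * (a * (lam m - r * b))) (ℕ→ℚ-* 12 p) (lamDiv-∤ k m p∤m) ⟩
  ℕ→ℚ m * (ℕ→ℚ 12 * P * (lam m - r * 0ℚ))
    ≡⟨ solve 5 (λ M c P L r → M :* (c :* P :* (L :- r :* con 0ℚ)) := P :* (c :* (M :* L)) :- P :* con 0ℚ)
               refl (ℕ→ℚ m) (ℕ→ℚ 12) P (lam m) r ⟩
  P * (ℕ→ℚ 12 * (ℕ→ℚ m * lam m)) - P * 0ℚ
    ≡⟨ cong₂ (λ x y → P * x - P * y) (sym (PLogDeriv-coeff m)) (sym (subPow-∤ k PLogDeriv m p∤m)) ⟩
  quotLogDeriv p m ∎
  where
  p = suc k
  P = ℕ→ℚ p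
  r = recipℕ p

θ-Uformula : ∀ k → θ (Uformula (suc k)) ≈ quotLogDeriv (suc k)
θ-Uformula k m with suc k ∣? m
... | yes (divides q m≡qp) = subst (λ m → θ (Uformula (suc k)) m ≡ quotLogDeriv (suc k) m) (sym m≡qp) (θ-Uformula-* k q)
... | no  p∤m              = θ-Uformula-∤ k m p∤m

U-coeff : ∀ k n → 1 ≤ n → U (suc k) n ≡ Uformula (suc k) n
U-coeff k (suc n) _ = ℕ→ℚ-*-cancelˡ n (trans (θ-U k (suc n)) (sym (θ-Uformula k (suc n))))

-- Denominators prime to p

↧ₙ-∣ : ∀ (z : ℚ) (g : ℤ) {a : ℕ} → ↧ z ℤ.* g ≡ + a → ↧ₙ z ∣ a
↧ₙ-∣ z g ↧z·g≡a = divides ℤ.∣ g ∣ (trans (sym (trans (sym (ℤₚ.abs-* (↧ z) g)) (cong ℤ.∣_∣ ↧z·g≡a)))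
                                         (ℕₚ.*-comm (↧ₙ z) ℤ.∣ g ∣))

IsIntegralAt : ℕ → ℚ → Set
IsIntegralAt p x = ¬ (p ∣ ↧ₙ x)

module _ {p} (p-prime : Prime p) where

  private
    ∤-* : ∀ {a b} → ¬ (p ∣ a) → ¬ (p ∣ b) → ¬ (p ∣ a ℕ.* b)
    ∤-* {a} {b} p∤a p∤b p∣ab with euclidsLemma a b p-prime p∣ab
    ... | inj₁ p∣a = p∤a p∣a
    ... | inj₂ p∣b = p∤b p∣b

  isIntegralAt-+ : ∀ x y → IsIntegralAt p x → IsIntegralAt p y → IsIntegralAt p (x + y)
  isIntegralAt-+ x@record{} y@record{} p∤x p∤y p∣x+y = ∤-* p∤x p∤y
    (∣-trans p∣x+y (↧ₙ-∣ (x + y) _ (↧-/ (↥ x ℤ.* ↧ y ℤ.+ ↥ y ℤ.* ↧ x) (↧ₙ x ℕ.* ↧ₙ y))))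

  isIntegralAt-* : ∀ x y → IsIntegralAt p x → IsIntegralAt p y → IsIntegralAt p (x * y)
  isIntegralAt-* x@record{} y@record{} p∤x p∤y p∣xy = ∤-* p∤x p∤y
    (∣-trans p∣xy (↧ₙ-∣ (x * y) _ (↧-/ (↥ x ℤ.* ↥ y) (↧ₙ x ℕ.* ↧ₙ y))))

  isIntegralAt-neg : ∀ x → IsIntegralAt p x → IsIntegralAt p (- x)
  isIntegralAt-neg x p∤x p∣-x = p∤x (subst (p ∣_) (cong ℤ.∣_∣ (↧-neg x)) p∣-x)

  isIntegralAt-ℕ→ℚ : ∀ n → IsIntegralAt p (ℕ→ℚ n)
  isIntegralAt-ℕ→ℚ n p∣↧n = ℕ.nonTrivial⇒≢1 {{prime⇒nonTrivial p-prime}}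
                              (∣1⇒≡1 (∣-trans p∣↧n (↧ₙ-∣ (ℕ→ℚ n) _ (↧-/ (+ n) 1))))

  isIntegralAt-recipℕ : ∀ {d} → ¬ (p ∣ d) → IsIntegralAt p (recipℕ d)
  isIntegralAt-recipℕ {zero}  _   = isIntegralAt-ℕ→ℚ 0
  isIntegralAt-recipℕ {suc d} p∤d p∣↧ = p∤d (∣-trans p∣↧ (↧ₙ-∣ (recipℕ (suc d)) _ (↧-/ (+ 1) (suc d))))

  isIntegralAt-sumTo : ∀ n (f : ℕ → ℚ) → (∀ i → i ≤ n → IsIntegralAt p (f i)) → IsIntegralAt p (sumTo n f)
  isIntegralAt-sumTo zero    f f∈ = f∈ 0 z≤n
  isIntegralAt-sumTo (suc n) f f∈ =
    isIntegralAt-+ (sumTo n f) (f (suc n)) (isIntegralAt-sumTo n f (λ i i≤n → f∈ i (ℕₚ.m≤n⇒m≤1+n i≤n)))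
                                           (f∈ (suc n) ℕₚ.≤-refl)

-- The coefficients at p^a m

module _ {k} (p-prime : Prime (suc k)) where

  private
    p = suc k
    r = recipℕ p

    p^a*t*p≡p^[1+a]*t : ∀ a t → p ^ a ℕ.* t ℕ.* p ≡ p ^ suc a ℕ.* t
    p^a*t*p≡p^[1+a]*t a t = trans (ℕₚ.*-comm (p ^ a ℕ.* t) p) (sym (ℕₚ.*-assoc p (p ^ a) t))

    ∤⇒nonZero : ∀ {t} → ¬ (p ∣ t) → NonZero t
    ∤⇒nonZero {zero}  p∤0 = contradiction (divides-refl 0) p∤0
    ∤⇒nonZero {suc _} _   = _

  ∤⇒coprime : ∀ {d} → ¬ (p ∣ d) → Coprime d p
  ∤⇒coprime p∤d (c∣d , c∣p) with prime⇒irreducible p-prime c∣p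
  ... | inj₁ c≡1    = c≡1
  ... | inj₂ refl   = contradiction c∣d p∤d

  ∣p^a*m⇒∣m : ∀ {d} a m → ¬ (p ∣ d) → d ∣ p ^ a ℕ.* m → d ∣ m
  ∣p^a*m⇒∣m {d} zero    m p∤d d∣m = subst (d ∣_) (ℕₚ.*-identityˡ m) d∣m
  ∣p^a*m⇒∣m {d} (suc a) m p∤d d∣  =
    ∣p^a*m⇒∣m a m p∤d (coprime-divisor (∤⇒coprime p∤d) (subst (d ∣_) (ℕₚ.*-assoc p (p ^ a) m) d∣))

  private
    recipℕ-*p : ∀ e → recipℕ (e ℕ.* p) ≡ r * recipℕ e
    recipℕ-*p zero    = sym (*-zeroʳ r)
    recipℕ-*p (suc e) = trans (recipℕ-* e k) (*-comm (recipℕ (suc e)) r)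

  -- The divisors of p^(a+1) t are the d ∣ t together with the e p for e ∣ p^a t.
  recipDivisorTerm-*p : ∀ a t → ¬ (p ∣ t) → ∀ d →
    recipDivisorTerm d (p ^ a ℕ.* t ℕ.* p)
      ≡ subPow p (scaleS r (λ e → recipDivisorTerm e (p ^ a ℕ.* t))) d + recipDivisorTerm d t
  recipDivisorTerm-*p a t p∤t d with p ∣? d
  ... | yes (divides-refl e) = begin
    recipDivisorTerm (e ℕ.* p) N                ≡⟨ multiple-of-p ⟩
    r * recipDivisorTerm e q                    ≡⟨ sym (+-identityʳ _) ⟩
    r * recipDivisorTerm e q + 0ℚ               ≡⟨ cong₂ _+_ (sym (subPow-* k lower e)) (sym (if-dec-no (e ℕ.* p ∣? t) ep∤t)) ⟩
    subPow p lower (e ℕ.* p) + recipDivisorTerm (e ℕ.* p) t ∎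
    where
    q = p ^ a ℕ.* t
    N = q ℕ.* p
    lower = scaleS r (λ e → recipDivisorTerm e q)
    ep∤t : ¬ (e ℕ.* p ∣ t)
    ep∤t ep∣t = p∤t (∣-trans (n∣m*n e) ep∣t)
    multiple-of-p : recipDivisorTerm (e ℕ.* p) N ≡ r * recipDivisorTerm e q
    multiple-of-p with e ∣? q
    ... | yes e∣q = trans (if-dec-yes (e ℕ.* p ∣? N) (*-monoˡ-∣ p e∣q)) (recipℕ-*p e)
    ... | no  e∤q = trans (if-dec-no (e ℕ.* p ∣? N) (λ ep∣N → e∤q (*-cancelʳ-∣ p ep∣N))) (sym (*-zeroʳ r))
  ... | no p∤d = begin
    recipDivisorTerm d (p ^ a ℕ.* t ℕ.* p)      ≡⟨ coprime-to-p ⟩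
    recipDivisorTerm d t                        ≡⟨ sym (+-identityˡ _) ⟩
    0ℚ + recipDivisorTerm d t                   ≡⟨ cong (_+ recipDivisorTerm d t) (sym (subPow-∤ k _ d p∤d)) ⟩
    subPow p (scaleS r (λ e → recipDivisorTerm e (p ^ a ℕ.* t))) d + recipDivisorTerm d t ∎
    where
    coprime-to-p : recipDivisorTerm d (p ^ a ℕ.* t ℕ.* p) ≡ recipDivisorTerm d t
    coprime-to-p with d ∣? t
    ... | yes d∣t = if-dec-yes (d ∣? _) (∣-trans d∣t (n∣m*n*o (p ^ a) p))
    ... | no  d∤t = if-dec-no (d ∣? _)
                      (λ d∣N → d∤t (∣p^a*m⇒∣m (suc a) t p∤d (subst (d ∣_) (p^a*t*p≡p^[1+a]*t a t) d∣N)))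

  σ₋₁-*p : ∀ a t → ¬ (p ∣ t) → σ₋₁ (p ^ a ℕ.* t ℕ.* p) ≡ r * σ₋₁ (p ^ a ℕ.* t) + σ₋₁ t
  σ₋₁-*p a t p∤t = begin
    sumTo N (λ d → recipDivisorTerm d N)
      ≡⟨ sumTo-cong N (λ d _ → recipDivisorTerm-*p a t p∤t d) ⟩
    sumTo N (λ d → subPow p lower d + recipDivisorTerm d t)
      ≡⟨ sumTo-distrib-+ N (subPow p lower) (λ d → recipDivisorTerm d t) ⟩
    sumTo N (subPow p lower) + sumTo N (λ d → recipDivisorTerm d t)
      ≡⟨ cong₂ _+_ (trans (cong (λ z → sumTo z (subPow p lower)) (sym (ℕₚ.+-identityʳ N)))
                          (trans (sumTo-subPow k lower q 0 z≤n) (sumTo-*ˡ q r _)))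
                   (sumTo-extend t≤N (λ d t<d _ → if-dec-no (d ∣? t) (>⇒∤ t<d))) ⟩
    r * σ₋₁ q + σ₋₁ t ∎
    where
    q = p ^ a ℕ.* t
    N = q ℕ.* p
    lower = scaleS r (λ e → recipDivisorTerm e q)
    instance
      t≢0 : NonZero t
      t≢0 = ∤⇒nonZero p∤t
    t≤N : t ≤ N
    t≤N = ∣⇒≤ {{ℕₚ.m*n≢0 q p {{ℕₚ.m*n≢0 (p ^ a) t {{ℕₚ.m^n≢0 p a}}}}}} (n∣m*n*o (p ^ a) p)

  σ₋₁div3-*p : ¬ (p ∣ 3) → ∀ a t → ¬ (p ∣ t) →
               σ₋₁div (p ^ a ℕ.* t ℕ.* p) 3 ≡ r * σ₋₁div (p ^ a ℕ.* t) 3 + σ₋₁div t 3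
  σ₋₁div3-*p p∤3 a t p∤t with 3 ∣? t
  ... | yes (divides-refl s) = begin
    σ₋₁div (p ^ a ℕ.* (s ℕ.* 3) ℕ.* p) 3  ≡⟨ cong (λ z → σ₋₁div z 3) N≡ ⟩
    σ₋₁div (p ^ a ℕ.* s ℕ.* p ℕ.* 3) 3    ≡⟨ σ₋₁div-* 2 (p ^ a ℕ.* s ℕ.* p) ⟩
    σ₋₁ (p ^ a ℕ.* s ℕ.* p)               ≡⟨ σ₋₁-*p a s (λ p∣s → p∤t (∣-trans p∣s (m∣m*n 3))) ⟩
    r * σ₋₁ (p ^ a ℕ.* s) + σ₋₁ s         ≡⟨ cong₂ (λ x y → r * x + y) (sym q/3) (sym (σ₋₁div-* 2 s)) ⟩
    r * σ₋₁div (p ^ a ℕ.* (s ℕ.* 3)) 3 + σ₋₁div (s ℕ.* 3) 3 ∎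
    where
    q≡ : p ^ a ℕ.* (s ℕ.* 3) ≡ p ^ a ℕ.* s ℕ.* 3
    q≡ = sym (ℕₚ.*-assoc (p ^ a) s 3)
    N≡ : p ^ a ℕ.* (s ℕ.* 3) ℕ.* p ≡ p ^ a ℕ.* s ℕ.* p ℕ.* 3
    N≡ = trans (cong (ℕ._* p) q≡) (xy∙z≈xz∙y (p ^ a ℕ.* s) 3 p)
    q/3 : σ₋₁div (p ^ a ℕ.* (s ℕ.* 3)) 3 ≡ σ₋₁ (p ^ a ℕ.* s)
    q/3 = trans (cong (λ z → σ₋₁div z 3) q≡) (σ₋₁div-* 2 (p ^ a ℕ.* s))
  ... | no 3∤t = begin
    σ₋₁div (q ℕ.* p) 3                ≡⟨ σ₋₁div-∤ 2 (q ℕ.* p) 3∤N ⟩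
    0ℚ                                ≡⟨ sym (trans (+-identityʳ _) (*-zeroʳ r)) ⟩
    r * 0ℚ + 0ℚ                       ≡⟨ cong₂ (λ x y → r * x + y) (sym (σ₋₁div-∤ 2 q 3∤q)) (sym (σ₋₁div-∤ 2 t 3∤t)) ⟩
    r * σ₋₁div q 3 + σ₋₁div t 3       ∎
    where
    q = p ^ a ℕ.* t
    3∤q : ¬ (3 ∣ q)
    3∤q 3∣q = 3∤t (∣p^a*m⇒∣m a t p∤3 3∣q)
    3∤N : ¬ (3 ∣ q ℕ.* p)
    3∤N 3∣N = 3∤t (∣p^a*m⇒∣m (suc a) t p∤3 (subst (3 ∣_) (p^a*t*p≡p^[1+a]*t a t) 3∣N))

  lam-*p : ¬ (p ∣ 3) → ∀ a t → ¬ (p ∣ t) → lam (p ^ a ℕ.* t ℕ.* p) ≡ r * lam (p ^ a ℕ.* t) + lam t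
  lam-*p p∤3 a t p∤t = begin
    σ₋₁ (q ℕ.* p) - σ₋₁div (q ℕ.* p) 3
      ≡⟨ cong₂ _-_ (σ₋₁-*p a t p∤t) (σ₋₁div3-*p p∤3 a t p∤t) ⟩
    (r * σ₋₁ q + σ₋₁ t) - (r * σ₋₁div q 3 + σ₋₁div t 3)
      ≡⟨ solve 5 (λ r A B C D → (r :* A :+ B) :- (r :* C :+ D) := r :* (A :- C) :+ (B :- D))
                 refl r (σ₋₁ q) (σ₋₁ t) (σ₋₁div q 3) (σ₋₁div t 3) ⟩
    r * lam q + lam t ∎
    where q = p ^ a ℕ.* t

  U-coeff-p^a*m : ¬ (p ∣ 3) → ∀ a m → ¬ (p ∣ m) → U p (p ^ a ℕ.* m) ≡ ℕ→ℚ (12 ℕ.* p) * lam m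
  U-coeff-p^a*m p∤3 zero m p∤m = begin
    U p (1 ℕ.* m)                        ≡⟨ cong (U p) (ℕₚ.*-identityˡ m) ⟩
    U p m                                ≡⟨ U-coeff k m (ℕ.>-nonZero⁻¹ m {{∤⇒nonZero p∤m}}) ⟩
    c * (lam m - r * lamDiv m p)         ≡⟨ cong (λ z → c * (lam m - r * z)) (lamDiv-∤ k m p∤m) ⟩
    c * (lam m - r * 0ℚ)                 ≡⟨ cong (c *_) (solve 2 (λ L r → L :- r :* con 0ℚ := L) refl (lam m) r) ⟩
    c * lam m                            ∎
    where c = ℕ→ℚ (12 ℕ.* p)
  U-coeff-p^a*m p∤3 (suc a) m p∤m = begin
    U p (p ^ suc a ℕ.* m)                ≡⟨ cong (U p) (sym (p^a*t*p≡p^[1+a]*t a m)) ⟩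
    U p (q ℕ.* p)                        ≡⟨ U-coeff k (q ℕ.* p) (ℕ.>-nonZero⁻¹ (q ℕ.* p) {{N≢0}}) ⟩
    c * (lam (q ℕ.* p) - r * lamDiv (q ℕ.* p) p)
      ≡⟨ cong₂ (λ x y → c * (x - r * y)) (lam-*p p∤3 a m p∤m) (lamDiv-* k q) ⟩
    c * ((r * lam q + lam m) - r * lam q)
      ≡⟨ cong (c *_) (solve 3 (λ r A L → (r :* A :+ L) :- r :* A := L) refl r (lam q) (lam m)) ⟩
    c * lam m ∎
    where
    c = ℕ→ℚ (12 ℕ.* p)
    q = p ^ a ℕ.* m
    N≢0 : NonZero (q ℕ.* p)
    N≢0 = ℕₚ.m*n≢0 q p {{ℕₚ.m*n≢0 (p ^ a) m {{ℕₚ.m^n≢0 p a}} {{∤⇒nonZero p∤m}}}}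

  p^a*m-decomposition : ∀ n → 1 ≤ n → ∃ λ a → ∃ λ m → ¬ (p ∣ m) × n ≡ p ^ a ℕ.* m
  p^a*m-decomposition = <-rec _ step
    where
    step : ∀ n → (∀ {q} → q < n → 1 ≤ q → ∃ λ a → ∃ λ m → ¬ (p ∣ m) × q ≡ p ^ a ℕ.* m) →
           1 ≤ n → ∃ λ a → ∃ λ m → ¬ (p ∣ m) × n ≡ p ^ a ℕ.* m
    step n rec 1≤n with p ∣? n
    ... | no  p∤n = 0 , n , p∤n , sym (ℕₚ.*-identityˡ n)
    ... | yes (divides zero n≡0) = contradiction (subst (1 ≤_) n≡0 1≤n) (λ ())
    ... | yes (divides (suc q) n≡qp) with rec q<n (s≤s z≤n)
      where
      q<n : suc q < n
      q<n = subst (suc q <_) (sym n≡qp) (ℕₚ.m<m*n (suc q) p (ℕ.nonTrivial⇒n>1 p {{prime⇒nonTrivial p-prime}}))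
    ...   | a , m , p∤m , q≡p^a*m =
      suc a , m , p∤m , trans n≡qp (trans (cong (ℕ._* p) q≡p^a*m) (p^a*t*p≡p^[1+a]*t a m))

  isIntegralAt-σ₋₁ : ∀ {m} → ¬ (p ∣ m) → IsIntegralAt p (σ₋₁ m)
  isIntegralAt-σ₋₁ {m} p∤m = isIntegralAt-sumTo p-prime m _ (λ d _ → term d)
    where
    term : ∀ d → IsIntegralAt p (if does (d ∣? m) then recipℕ d else 0ℚ)
    term d with d ∣? m
    ... | yes d∣m = isIntegralAt-recipℕ p-prime (λ p∣d → p∤m (∣-trans p∣d d∣m))
    ... | no  _   = isIntegralAt-ℕ→ℚ p-prime 0

  isIntegralAt-lam : ∀ {m} → ¬ (p ∣ m) → IsIntegralAt p (lam m)
  isIntegralAt-lam {m} p∤m = isIntegralAt-+ p-prime (σ₋₁ m) (- σ₋₁div m 3) (isIntegralAt-σ₋₁ p∤m)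
                                          (isIntegralAt-neg p-prime (σ₋₁div m 3) σ₋₁[m/3]-integral)
    where
    σ₋₁[m/3]-integral : IsIntegralAt p (σ₋₁div m 3)
    σ₋₁[m/3]-integral with 3 ∣? m
    ... | yes (divides-refl s) = subst (IsIntegralAt p) (sym (σ₋₁div-* 2 s))
                                       (isIntegralAt-σ₋₁ {s} (λ p∣s → p∤m (∣-trans p∣s (m∣m*n 3))))
    ... | no  3∤m              = subst (IsIntegralAt p) (sym (σ₋₁div-∤ 2 m 3∤m)) (isIntegralAt-ℕ→ℚ p-prime 0)

  U-divisible-by-p : ¬ (p ∣ 3) → ∀ n → ∃ λ c → IsIntegralAt p c × U p n ≡ ℕ→ℚ p * c
  U-divisible-by-p p∤3 zero    = 0ℚ , isIntegralAt-ℕ→ℚ p-prime 0 , sym (*-zeroʳ (ℕ→ℚ p))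
  U-divisible-by-p p∤3 (suc n) with p^a*m-decomposition (suc n) (s≤s z≤n)
  ... | a , m , p∤m , n≡p^a*m =
    ℕ→ℚ 12 * lam m ,
    isIntegralAt-* p-prime (ℕ→ℚ 12) (lam m) (isIntegralAt-ℕ→ℚ p-prime 12) (isIntegralAt-lam p∤m) ,
    (begin
      U p (suc n)                 ≡⟨ cong (U p) n≡p^a*m ⟩
      U p (p ^ a ℕ.* m)           ≡⟨ U-coeff-p^a*m p∤3 a m p∤m ⟩
      ℕ→ℚ (12 ℕ.* p) * lam m      ≡⟨ cong (_* lam m) (ℕ→ℚ-* 12 p) ⟩
      ℕ→ℚ 12 * ℕ→ℚ p * lam m      ≡⟨ solve 3 (λ a b c → a :* b :* c := b :* (a :* c)) refl
                                                 (ℕ→ℚ 12) (ℕ→ℚ p) (lam m) ⟩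
      ℕ→ℚ p * (ℕ→ℚ 12 * lam m)    ∎)

lemma5p2 : ∀ (p : ℕ) → Prime p → 5 ≤ p →
    (U p 0 ≡ 0ℚ)
    × (∀ (n : ℕ) → ∃ λ (c : ℚ) → (¬ (p ∣ (↧ₙ c))) × (U p n ≡ ℕ→ℚ p * c))
    × (∀ (n : ℕ) → 1 ≤ n →
         U p n ≡ ℕ→ℚ (12 Data.Nat.* p) * (lam n - recipℕ p * lamDiv n p))
    × (∀ (a m : ℕ) → ¬ (p ∣ m) →
         U p (p ^ a Data.Nat.* m) ≡ ℕ→ℚ (12 Data.Nat.* p) * lam m)
lemma5p2 (suc k) p-prime 5≤p = refl , U-divisible-by-p p-prime p∤3 , U-coeff k , U-coeff-p^a*m p-prime p∤3
  where
  p∤3 : ¬ (suc k ∣ 3)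
  p∤3 p∣3 = ℕₚ.<⇒≱ (ℕₚ.<-≤-trans (s≤s (s≤s (s≤s (s≤s z≤n)))) 5≤p) (∣⇒≤ p∣3)
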